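{- Let $s$ be a nonnegative integer and $d\geq3$ an integer. Let $\mathcal{M}_{s,d}=\mathrm{conv}\{\mathbf{0},\mathbf{e}_1,\ldots,\mathbf{e}_{d-1},\omega\}\subset\mathbb{R}^d$, where $$\omega=\begin{cases}(\underbrace{1,\ldots,1}_{k-1},\underbrace{s,\ldots,s}_{k-1},s+1) & \text{if } d=2k-1,\\ (\underbrace{1,\ldots,1}_{k},\underbrace{s,\ldots,s}_{k-1},s+1) & \text{if } d=2k.\end{cases}$$ Then $h^*_{\mathcal{M}_{s,d}}(x)=sx^k+1$.
   Context: $\mathbf{e}_i$ is the $i$-th unit coordinate vector of $\mathbb{R}^d$ and $\mathbf{0}$ the origin. For a $d$-dimensional integral polytope $\mathcal{P}$ with Ehrhart polynomial $i(\mathcal{P},t)=\#(t\mathcal{P}\cap\mathbb{Z}^d)$, the $h^*$-polynomial is defined by $1+\sum_{t\geq1}i(\mathcal{P},t)x^t=h^*_{\mathcal{P}}(x)/(1-x)^{d+1}$. -}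

module Defs where

open import Data.Nat as ℕ using (ℕ; zero; suc; _∸_; _<ᵇ_; _≡ᵇ_)
open import Data.Nat.Combinatorics using (_C_)
open import Data.Integer as ℤ using (ℤ; +_)
open import Data.Rational as ℚ using (ℚ; 0ℚ; _/_)
open import Data.Fin using (Fin; zero; suc; toℕ)
open import Data.Vec using (Vec; lookup)
open import Data.Bool using (if_then_else_)
open import Data.List using (List)
open import Data.List.Membership.Propositional using (_∈_)
open import Data.List.Relation.Unary.Unique.Propositional using (Unique)
open import Data.Product using (Σ; _×_)
open import Function.Bundles using (_⇔_)
open import Relation.Binary.PropositionalEquality using (_≡_)

ℤ→ℚ : ℤ → ℚ
ℤ→ℚ z = z / 1

Σℚ : (n : ℕ) → (Fin n → ℚ) → ℚ
Σℚ zero    f = 0ℚ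
Σℚ (suc n) f = f zero ℚ.+ Σℚ n (λ i → f (suc i))

Σℤ≤ : ℕ → (ℕ → ℤ) → ℤ
Σℤ≤ zero    f = f 0
Σℤ≤ (suc n) f = Σℤ≤ n f ℤ.+ f (suc n)

InDilate : (d m : ℕ) → (Fin m → Vec ℤ d) → ℕ → Vec ℤ d → Set
InDilate d m v t x =
  Σ (Fin m → ℚ) λ lam →
    ((j : Fin m) → 0ℚ ℚ.≤ lam j)
    × (Σℚ m lam ≡ ℤ→ℚ (+ t))
    × ((i : Fin d) → ℤ→ℚ (lookup x i) ≡ Σℚ m (λ j → lam j ℚ.* ℤ→ℚ (lookup (v j) i)))

LatticeCount : (d m : ℕ) → (Fin m → Vec ℤ d) → ℕ → ℕ → Set
LatticeCount d m v t n =
  Σ (List (Vec ℤ d)) λ xs →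
    (Data.List.length xs ≡ n) × Unique xs × ((x : Vec ℤ d) → (x ∈ xs) ⇔ InDilate d m v t x)

-- The point ω ∈ ℤ^d (0-indexed coordinates i):
--   d = 2k-1 : (1^{k-1}, s^{k-1}, s+1);  d = 2k : (1^k, s^{k-1}, s+1).
-- In both cases the number of leading 1's is d ∸ k.
ω-coord : (s d k : ℕ) → Fin d → ℤ
ω-coord s d k i =
  if toℕ i <ᵇ (d ∸ k) then + 1
  else if toℕ i <ᵇ (d ∸ 1) then + s
  else + (suc s)

ω : (s d k : ℕ) → Vec ℤ d
ω s d k = Data.Vec.tabulate (ω-coord s d k)

e : (d : ℕ) → Fin d → Vec ℤ d
e d j = Data.Vec.tabulate (λ i → if toℕ i ≡ᵇ toℕ j then + 1 else + 0)

-- the d+1 vertices 0, e_1, …, e_{d-1}, ω of M_{s,d}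
-- (vertex 0 is the origin, vertex (suc j) is e_{j+1} for toℕ j < d-1, and ω for j = d-1)
M-vertices : (s d k : ℕ) → Fin (suc d) → Vec ℤ d
M-vertices s d k zero    = Data.Vec.replicate d (+ 0)
M-vertices s d k (suc j) = if toℕ j <ᵇ (d ∸ 1) then e d j else ω s d k

ehrhartSeries : (ℕ → ℕ) → ℕ → ℤ
ehrhartSeries i zero    = + 1
ehrhartSeries i (suc t) = + (i (suc t))

-- coefficient n of (1-x)^{d+1} · F(x)
hstarCoeff : (d : ℕ) → (ℕ → ℤ) → ℕ → ℤ
hstarCoeff d F n =
  Σℤ≤ n (λ j → ((ℤ.- (+ 1)) ℤ.^ j) ℤ.* (+ ((suc d) C j)) ℤ.* F (n ∸ j))

target : (s k : ℕ) → ℕ → ℤ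
target s k n = (if n ≡ᵇ 0 then + 1 else + 0) ℤ.+ (if n ≡ᵇ k then + s else + 0)

-- Let S = s + 1 and, for a lattice point x = (x₁, …, x_d), let c = x_d. The vertices 0, e₁, …,
-- e_{d−1}, ω of M are affinely independent, and S times the barycentric coordinates of x in tM
-- are the integers  S t − S Σ_{i<d} xᵢ + c (Σ_{i<d} ωᵢ − 1),  S xᵢ − ωᵢ c (i < d)  and  c;  so x lies
-- in tM iff they are nonnegative. Divide c = S q + r with 0 ≤ r ≤ s. Since ωᵢ ∈ {1, s}, the middle
-- conditions say xᵢ = pᵢ + ωᵢ q + ⌈ωᵢ r / S⌉ with pᵢ ≥ 0, and since ω has a ones and b entries s
-- among its first d − 1 coordinates with a − b ∈ {0, 1}, the first one becomes Σ p ≤ t for r = 0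
-- and Σ p + k ≤ t for r > 0, where p_d = q. Hence x ↦ (r, p) is a bijection and
--   i(t) = C(t + d, d) + s · C(t − k + d, d)   (the second term only when k ≤ t);
-- multiplying Σ_t i(t) xᵗ by (1 − x)^{d+1}, i.e. taking d + 1 differences, leaves 1 + s x^k.

module Submission where

open import Defs
open import Algebra.Bundles using (Monoid; Ring)
import Algebra.Properties.Monoid.Sum as MonoidSum
import Algebra.Properties.Semiring.Sum as SemiringSum
open import Data.Bool using (Bool; true; false; if_then_else_; T)
open import Data.Bool.Properties using (if-eta; if-idem-then; if-cong)
open import Data.Empty using (⊥)
open import Data.Fin using (Fin; zero; suc; toℕ; fromℕ)
import Data.Fin.Properties as FinP
open import Data.Integer as ℤ using (ℤ; +_; 0ℤ)
import Data.Integer.Properties as ℤP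
import Data.Integer.Tactic.RingSolver as ℤ-Solver
open import Data.List using (List; []; _∷_; [_]; _++_; map; length; cartesianProduct; applyUpTo)
import Data.List.Properties as ListP
open import Data.List.Membership.Propositional using (_∈_)
open import Data.List.Membership.Propositional.Properties
open import Data.List.Relation.Unary.All as All using (All)
open import Data.List.Relation.Unary.Any using (here)
open import Data.List.Relation.Unary.Unique.Propositional using (Unique)
import Data.List.Relation.Unary.Unique.Propositional.Properties as Unique
open import Data.Nat
open import Data.Nat.Combinatorics using (_C_; nCn≡1; nCk+nC[k+1]≡[n+1]C[k+1])
import Data.Nat.Coprimality as Coprime
open import Data.Nat.DivMod using (m≡m%n+[m/n]*n; [m+kn]%n≡m%n; m<n⇒m%n≡m; m%n<n)
open import Data.Nat.Properties
import Data.Nat.Tactic.RingSolver as ℕ-Solver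
open import Data.Product using (Σ; _×_; _,_; proj₁; proj₂)
open import Data.Rational as ℚ using (ℚ; mkℚ; 0ℚ; 1ℚ)
import Data.Rational.Properties as ℚP
import Data.Rational.Unnormalised as ℚᵘ
import Data.Rational.Unnormalised.Properties as ℚᵘP
open import Data.Sum using (_⊎_; inj₁; inj₂)
open import Data.Unit using (tt)
open import Data.Vec as Vec using (Vec; lookup; tabulate)
import Data.Vec.Properties as VecP
open import Function using (_∘_; _∘′_)
open import Function.Bundles using (_⇔_; mk⇔; Equivalence)
open import Function.Properties.Equivalence using () renaming (trans to ⇔-trans)
open import Level using (0ℓ)
open import Relation.Binary.PropositionalEquality using (_≡_; refl; sym; trans; cong; cong₂; subst; subst₂; module ≡-Reasoning)
open import Relation.Nullary using (¬_; yes; no; contradiction)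
open import Relation.Nullary.Decidable using (dec⇒maybe)
import Tactic.RingSolver as RingSolver
open import Tactic.RingSolver.Core.AlmostCommutativeRing using (AlmostCommutativeRing; fromCommutativeRing)

module ℕΣ = SemiringSum +-*-semiring
module ℤΣ = SemiringSum ℤP.+-*-semiring
module ℚΣ = SemiringSum (Ring.semiring ℚP.+-*-ring)

module _ {c ℓ} (M : Monoid c ℓ) where
  open Monoid M renaming (trans to ≈-trans; sym to ≈-sym)
  open MonoidSum M using (sum; sum-replicate-zero)

  sum-split-last : ∀ n (f : Fin (suc n) → Carrier) →
                   sum f ≈ sum (λ i → if toℕ i <ᵇ n then f i else ε) ∙ f (fromℕ n)
  sum-split-last zero    f = ≈-trans (identityʳ (f zero)) (≈-sym (≈-trans (∙-congʳ (identityʳ ε)) (identityˡ (f zero))))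
  sum-split-last (suc n) f = ≈-trans (∙-congˡ (sum-split-last n (f ∘ suc))) (≈-sym (assoc _ _ _))

  sum-indicator : ∀ n (g : Fin n → Carrier) (i : Fin n) →
                  sum (λ j → if toℕ i ≡ᵇ toℕ j then g j else ε) ≈ g i
  sum-indicator (suc n) g zero    = ≈-trans (∙-congˡ (sum-replicate-zero n)) (identityʳ (g zero))
  sum-indicator (suc n) g (suc i) = ≈-trans (identityˡ _) (sum-indicator n (g ∘ suc) i)

Σℚ≡sum : ∀ n (f : Fin n → ℚ) → Σℚ n f ≡ ℚΣ.sum f
Σℚ≡sum zero    f = refl
Σℚ≡sum (suc n) f = cong (f zero ℚ.+_) (Σℚ≡sum n (f ∘ suc))

sum-threshold : ∀ n m α β → m ≤ n →
  ℕΣ.sum {suc n} (λ i → if toℕ i <ᵇ n then (if toℕ i <ᵇ m then α else β) else 0) ≡ m * α + (n ∸ m) * β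
sum-threshold zero    zero    α β _         = refl
sum-threshold (suc n) zero    α β _         = cong (_+_ β) (sum-threshold n zero α β z≤n)
sum-threshold (suc n) (suc m) α β (s≤s m≤n) = trans (cong (_+_ α) (sum-threshold n m α β m≤n)) (sym (+-assoc α (m * α) _))

Vec-sum≡sum-lookup : ∀ {m} (v : Vec ℕ m) → Vec.sum v ≡ ℕΣ.sum (lookup v)
Vec-sum≡sum-lookup Vec.[]      = refl
Vec-sum≡sum-lookup (x Vec.∷ v) = cong (_+_ x) (Vec-sum≡sum-lookup v)

sum-pos-minus-pos : ∀ n (P Q : Fin n → ℕ) → ℤΣ.sum (λ i → + P i ℤ.- + Q i) ≡ + ℕΣ.sum P ℤ.- + ℕΣ.sum Q
sum-pos-minus-pos zero    P Q = refl
sum-pos-minus-pos (suc n) P Q = begin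
    (+ P zero ℤ.- + Q zero) ℤ.+ ℤΣ.sum (λ i → + P (suc i) ℤ.- + Q (suc i))
  ≡⟨ cong (ℤ._+_ (+ P zero ℤ.- + Q zero)) (sum-pos-minus-pos n (P ∘ suc) (Q ∘ suc)) ⟩
    (+ P zero ℤ.- + Q zero) ℤ.+ (+ ℕΣ.sum (P ∘ suc) ℤ.- + ℕΣ.sum (Q ∘ suc))
  ≡⟨ interchange (+ P zero) (+ Q zero) (+ ℕΣ.sum (P ∘ suc)) (+ ℕΣ.sum (Q ∘ suc)) ⟩
    (+ P zero ℤ.+ + ℕΣ.sum (P ∘ suc)) ℤ.- (+ Q zero ℤ.+ + ℕΣ.sum (Q ∘ suc))
  ≡⟨ cong₂ ℤ._-_ (ℤP.pos-+ (P zero) _) (ℤP.pos-+ (Q zero) _) ⟨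
    + ℕΣ.sum P ℤ.- + ℕΣ.sum Q
  ∎
  where
  open ≡-Reasoning
  interchange : ∀ a b c e → (a ℤ.- b) ℤ.+ (c ℤ.- e) ≡ (a ℤ.+ c) ℤ.- (b ℤ.+ e)
  interchange = ℤ-Solver.solve-∀

-- The zero test lets the ring solver cancel opposite terms.
ℚ-ring : AlmostCommutativeRing 0ℓ 0ℓ
ℚ-ring = fromCommutativeRing ℚP.+-*-commutativeRing (λ q → dec⇒maybe (0ℚ ℚP.≟ q))

-- The normal form of z / 1; unlike ℤ→ℚ z it is a constructor form, so arithmetic on it and its
-- NonZero and NonNegative instances compute.
ι : ℤ → ℚ
ι z = mkℚ z 0 (Coprime.sym (Coprime.1-coprimeTo _))

ℤ→ℚ≡ι : ∀ z → ℤ→ℚ z ≡ ι z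
ℤ→ℚ≡ι z = ℚP.↥p/↧p≡p (ι z)

ι-homo-+ : ∀ a b → ι (a ℤ.+ b) ≡ ι a ℚ.+ ι b
ι-homo-+ a b = ℚP.toℚᵘ-injective (ℚᵘP.≃-trans (ℚᵘ.*≡* eq) (ℚᵘP.≃-sym (ℚP.toℚᵘ-homo-+ (ι a) (ι b))))
  where
  eq : (a ℤ.+ b) ℤ.* ℚᵘ.↧ (ℚ.toℚᵘ (ι a) ℚᵘ.+ ℚ.toℚᵘ (ι b))
     ≡ ℚᵘ.↥ (ℚ.toℚᵘ (ι a) ℚᵘ.+ ℚ.toℚᵘ (ι b)) ℤ.* + 1
  eq = cong (ℤ._* + 1) (cong₂ ℤ._+_ (sym (ℤP.*-identityʳ a)) (sym (ℤP.*-identityʳ b)))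

ι-homo-* : ∀ a b → ι (a ℤ.* b) ≡ ι a ℚ.* ι b
ι-homo-* a b = ℚP.toℚᵘ-injective (ℚᵘP.≃-trans (ℚᵘ.*≡* refl) (ℚᵘP.≃-sym (ℚP.toℚᵘ-homo-* (ι a) (ι b))))

ι-homo‿- : ∀ a → ι (ℤ.- a) ≡ ℚ.- ι a
ι-homo‿- a = ℚP.toℚᵘ-injective (ℚᵘP.≃-trans (ℚᵘ.*≡* refl) (ℚᵘP.≃-sym (ℚP.toℚᵘ-homo‿- (ι a))))

ι-homo-− : ∀ a b → ι (a ℤ.- b) ≡ ι a ℚ.- ι b
ι-homo-− a b = trans (ι-homo-+ a (ℤ.- b)) (cong (ι a ℚ.+_) (ι-homo‿- b))

ι-homo-sum : ∀ n (f : Fin n → ℤ) → ι (ℤΣ.sum f) ≡ ℚΣ.sum (ι ∘ f)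
ι-homo-sum zero    f = sym (ℤ→ℚ≡ι 0ℤ)
ι-homo-sum (suc n) f = trans (ι-homo-+ (f zero) _) (cong (ι (f zero) ℚ.+_) (ι-homo-sum n (f ∘ suc)))

ι-mono-≤ : ∀ {a b} → a ℤ.≤ b → ι a ℚ.≤ ι b
ι-mono-≤ {a} {b} a≤b = ℚ.*≤* (subst₂ ℤ._≤_ (sym (ℤP.*-identityʳ a)) (sym (ℤP.*-identityʳ b)) a≤b)

ι-cancel-≤ : ∀ {a b} → ι a ℚ.≤ ι b → a ℤ.≤ b
ι-cancel-≤ {a} {b} (ℚ.*≤* a≤b) = subst₂ ℤ._≤_ (ℤP.*-identityʳ a) (ℤP.*-identityʳ b) a≤b

*-nonNeg : ∀ {p q} → 0ℚ ℚ.≤ p → 0ℚ ℚ.≤ q → 0ℚ ℚ.≤ p ℚ.* q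
*-nonNeg {p} {q} p≥0 q≥0 = subst (ℚ._≤ p ℚ.* q) (ℚP.*-zeroʳ p) (ℚP.*-monoˡ-≤-nonNeg p {{ℚ.nonNegative p≥0}} q≥0)

0≤+m-+n⇔n≤m : ∀ m n → 0ℤ ℤ.≤ + m ℤ.- + n ⇔ n ≤ m
0≤+m-+n⇔n≤m m n = mk⇔ (ℤP.drop‿+≤+ ∘ ℤP.0≤i-j⇒j≤i) (ℤP.i≤j⇒0≤j-i ∘ ℤ.+≤+)

0≤x⇒map+∣x∣≡x : ∀ {m} (x : Vec ℤ m) → (∀ i → 0ℤ ℤ.≤ lookup x i) → Vec.map +_ (Vec.map ℤ.∣_∣ x) ≡ x
0≤x⇒map+∣x∣≡x Vec.[]        _   = refl
0≤x⇒map+∣x∣≡x (z Vec.∷ x) 0≤x = cong₂ Vec._∷_ (ℤP.0≤i⇒+∣i∣≡i (0≤x zero)) (0≤x⇒map+∣x∣≡x x (0≤x ∘ suc))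

n≤m⇒m<ᵇn≡false : ∀ {m n} → n ≤ m → (m <ᵇ n) ≡ false
n≤m⇒m<ᵇn≡false {m} {n} n≤m with m <ᵇ n in eq
... | false = refl
... | true  = contradiction n≤m (<⇒≱ (<ᵇ⇒< m n (subst T (sym eq) tt)))

signum : ℕ → ℕ
signum zero    = 0
signum (suc _) = 1

*-+-cancel-≤⇔ : ∀ m x t c → suc m * x + c ≤ suc m * t + c ⇔ x ≤ t
*-+-cancel-≤⇔ m x t c = mk⇔ (*-cancelˡ-≤ (suc m) ∘′ +-cancelʳ-≤ c (suc m * x) (suc m * t))
                            (+-monoˡ-≤ c ∘′ *-monoʳ-≤ (suc m))

[1+s]q+r≤[1+s]y⇔q+sgn[r]≤y : ∀ {s q r y} → r ≤ s → suc s * q + r ≤ suc s * y ⇔ q + signum r ≤ y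
[1+s]q+r≤[1+s]y⇔q+sgn[r]≤y {s} {q} {zero} {y} _ =
  mk⇔ (λ h → subst (_≤ y) (sym (+-identityʳ q)) (*-cancelˡ-≤ (suc s) (subst (_≤ suc s * y) (+-identityʳ _) h)))
      (λ h → subst (_≤ suc s * y) (sym (+-identityʳ _)) (*-monoʳ-≤ (suc s) (subst (_≤ y) (+-identityʳ q) h)))
[1+s]q+r≤[1+s]y⇔q+sgn[r]≤y {s} {q} {suc r} {y} 1+r≤s = mk⇔ to from
  where
  to : suc s * q + suc r ≤ suc s * y → q + 1 ≤ y
  to h = subst (_≤ y) (+-comm 1 q) (*-cancelˡ-< (suc s) q y (<-≤-trans (m<m+n (suc s * q) z<s) h))
  from : q + 1 ≤ y → suc s * q + suc r ≤ suc s * y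
  from h = begin
    suc s * q + suc r  ≤⟨ +-monoʳ-≤ (suc s * q) (m≤n⇒m≤1+n 1+r≤s) ⟩
    suc s * q + suc s  ≡⟨ rearrange s q ⟩
    suc s * (q + 1)    ≤⟨ *-monoʳ-≤ (suc s) h ⟩
    suc s * y          ∎
    where
    open ≤-Reasoning
    rearrange : ∀ s q → suc s * q + suc s ≡ suc s * (q + 1)
    rearrange = ℕ-Solver.solve-∀

s[[1+s]q+r]≤[1+s]y⇔sq+r≤y : ∀ {s q r y} → r ≤ s → s * (suc s * q + r) ≤ suc s * y ⇔ s * q + r ≤ y
s[[1+s]q+r]≤[1+s]y⇔sq+r≤y {s} {q} {r} {y} r≤s = mk⇔ to from
  where
  open ≤-Reasoning
  expand : ∀ s q r → suc s * (s * q + r) ≡ s * (suc s * q + r) + r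
  expand = ℕ-Solver.solve-∀
  from : s * q + r ≤ y → s * (suc s * q + r) ≤ suc s * y
  from h = begin
    s * (suc s * q + r)      ≤⟨ m≤m+n _ r ⟩
    s * (suc s * q + r) + r  ≡⟨ expand s q r ⟨
    suc s * (s * q + r)      ≤⟨ *-monoʳ-≤ (suc s) h ⟩
    suc s * y                ∎
  to : s * (suc s * q + r) ≤ suc s * y → s * q + r ≤ y
  to h with s * q + r ≤? y
  ... | yes sq+r≤y = sq+r≤y
  ... | no  sq+r≰y = contradiction r≤s (<⇒≱ (+-cancelˡ-≤ (suc s * y) (suc s) r (begin
    suc s * y + suc s        ≡⟨ rearrange s y ⟩
    suc s * suc y            ≤⟨ *-monoʳ-≤ (suc s) (≰⇒> sq+r≰y) ⟩
    suc s * (s * q + r)      ≡⟨ expand s q r ⟩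
    s * (suc s * q + r) + r  ≤⟨ +-monoˡ-≤ r h ⟩
    suc s * y + r            ∎)))
    where
    rearrange : ∀ s y → suc s * y + suc s ≡ suc s * suc y
    rearrange = ℕ-Solver.solve-∀

+-cancelʳ-≤⇔ : ∀ c {x y} → x + c ≤ y + c ⇔ x ≤ y
+-cancelʳ-≤⇔ c {x} {y} = mk⇔ (+-cancelʳ-≤ c x y) (+-monoˡ-≤ c)

Bound : ℕ → ℕ → ℕ → ℕ → Set
Bound k t zero    m = m ≤ t
Bound k t (suc _) m = m + k ≤ t

-- Here a · 1 + b · s = Σ ωᵢ and a · sgn r + b · r = Σ ⌈ωᵢ r / S⌉ over the inner coordinates; the
-- total condition reduces to a bound on U + q only because a − b ∈ {0, 1}.
balanced-bound⇔ : ∀ {s a b} t r U q → a ≡ b ⊎ a ≡ suc b → r ≤ s →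
  suc s * (U + q * (a * 1 + b * s) + (a * signum r + b * r)) + (suc s * q + r) ≤ suc s * t + (suc s * q + r) * (a * 1 + b * s)
  ⇔ Bound (suc b) t r (U + q)
balanced-bound⇔ {s} {a} {b} t zero U q _ _ =
  subst₂ (λ X Y → X ≤ Y ⇔ U + q ≤ t) (sym (lhs s a b U q)) (sym (rhs s a b t q))
         (*-+-cancel-≤⇔ s (U + q) t (suc s * q * (a * 1 + b * s)))
  where
  lhs : ∀ s a b U q → suc s * (U + q * (a * 1 + b * s) + (a * 0 + b * 0)) + (suc s * q + 0) ≡ suc s * (U + q) + suc s * q * (a * 1 + b * s)
  lhs = ℕ-Solver.solve-∀
  rhs : ∀ s a b t q → suc s * t + (suc s * q + 0) * (a * 1 + b * s) ≡ suc s * t + suc s * q * (a * 1 + b * s)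
  rhs = ℕ-Solver.solve-∀
balanced-bound⇔ {s} {_} {b} t (suc r) U q (inj₂ refl) _ =
  subst₂ (λ X Y → X ≤ Y ⇔ U + q + suc b ≤ t) (sym (lhs s b U q r)) (sym (rhs s b t q r))
         (*-+-cancel-≤⇔ s (U + q + suc b) t (suc s * q * (suc b * 1 + b * s) + b * suc r + suc r + s * b * suc r))
  where
  lhs : ∀ s b U q r → suc s * (U + q * (suc b * 1 + b * s) + (suc b * 1 + b * suc r)) + (suc s * q + suc r)
                     ≡ suc s * (U + q + suc b) + (suc s * q * (suc b * 1 + b * s) + b * suc r + suc r + s * b * suc r)
  lhs = ℕ-Solver.solve-∀
  rhs : ∀ s b t q r → suc s * t + (suc s * q + suc r) * (suc b * 1 + b * s)
                     ≡ suc s * t + (suc s * q * (suc b * 1 + b * s) + b * suc r + suc r + s * b * suc r)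
  rhs = ℕ-Solver.solve-∀
balanced-bound⇔ {s} {_} {b} t (suc r) U q (inj₁ refl) 1+r≤s =
  subst₂ (λ X Y → X ≤ Y ⇔ U + q + suc b ≤ t) (sym (lhs s b U q r)) (sym (rhs s b t q r))
         (⇔-trans (+-cancelʳ-≤⇔ common) (subst (λ m → X ≤ Y ⇔ m ≤ t) X+1≡ (core (U + q + b))))
  where
  common X Y : ℕ
  common = suc s * q * (b * 1 + b * s) + b * suc r + s * b * suc r
  X = suc s * (U + q + b) + suc r
  Y = suc s * t
  core : ∀ x → suc s * x + suc r ≤ suc s * t ⇔ x + 1 ≤ t
  core x = [1+s]q+r≤[1+s]y⇔q+sgn[r]≤y 1+r≤s
  X+1≡ : U + q + b + 1 ≡ U + q + suc b
  X+1≡ = trans (+-comm (U + q + b) 1) (sym (+-suc (U + q) b))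
  lhs : ∀ s b U q r → suc s * (U + q * (b * 1 + b * s) + (b * 1 + b * suc r)) + (suc s * q + suc r)
                     ≡ suc s * (U + q + b) + suc r + (suc s * q * (b * 1 + b * s) + b * suc r + s * b * suc r)
  lhs = ℕ-Solver.solve-∀
  rhs : ∀ s b t q r → suc s * t + (suc s * q + suc r) * (b * 1 + b * s)
                     ≡ suc s * t + (suc s * q * (b * 1 + b * s) + b * suc r + s * b * suc r)
  rhs = ℕ-Solver.solve-∀

divMod-unique : ∀ {s q r} → r ≤ s → (suc s * q + r) % suc s ≡ r × (suc s * q + r) / suc s ≡ q
divMod-unique {s} {q} {r} r≤s = mod , div
  where
  c≡ : suc s * q + r ≡ r + q * suc s
  c≡ = trans (+-comm (suc s * q) r) (cong (_+_ r) (*-comm (suc s) q))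
  mod : (suc s * q + r) % suc s ≡ r
  mod = trans (cong (_% suc s) c≡) (trans ([m+kn]%n≡m%n r q (suc s)) (m<n⇒m%n≡m (s≤s r≤s)))
  div : (suc s * q + r) / suc s ≡ q
  div = *-cancelʳ-≡ _ q (suc s) (+-cancelˡ-≡ r _ _
          (trans (sym (trans (m≡m%n+[m/n]*n _ (suc s)) (cong (_+ (suc s * q + r) / suc s * suc s) mod))) c≡))

-- Lists of vectors of bounded sum

Unique-map⁺ : ∀ {A B : Set} {f : A → B} (g : B → A) {xs} → All (λ x → g (f x) ≡ x) xs → Unique xs → Unique (map f xs)
Unique-map⁺ {f = f} g {xs} g∘f≡id unique-xs =
  Unique.map⁻ {f = g} (subst Unique (sym (trans (sym (ListP.map-∘ xs)) (ListP.map-id-local g∘f≡id))) unique-xs)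

length-cartesianProduct : ∀ {A B : Set} (xs : List A) (ys : List B) → length (cartesianProduct xs ys) ≡ length xs * length ys
length-cartesianProduct []       ys = refl
length-cartesianProduct (x ∷ xs) ys = begin
  length (map (x ,_) ys ++ cartesianProduct xs ys)        ≡⟨ ListP.length-++ (map (x ,_) ys) ⟩
  length (map (x ,_) ys) + length (cartesianProduct xs ys) ≡⟨ cong₂ _+_ (ListP.length-map (x ,_) ys) (length-cartesianProduct xs ys) ⟩
  length ys + length xs * length ys                       ∎
  where open ≡-Reasoning

incrementHead : ∀ {m} → Vec ℕ (suc m) → Vec ℕ (suc m)
incrementHead (x Vec.∷ v) = suc x Vec.∷ v

bounded : (m T : ℕ) → List (Vec ℕ m)
bounded zero    T       = [ Vec.[] ]
bounded (suc m) zero    = map (0 Vec.∷_) (bounded m zero)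
bounded (suc m) (suc T) = map (0 Vec.∷_) (bounded m (suc T)) ++ map incrementHead (bounded (suc m) T)

∈-bounded⇒ : ∀ m T {v} → v ∈ bounded m T → Vec.sum v ≤ T
∈-bounded⇒ zero    T       {Vec.[]} _ = z≤n
∈-bounded⇒ (suc m) zero    v∈ with _ , w∈ , refl ← ∈-map⁻ (0 Vec.∷_) v∈ = ∈-bounded⇒ m zero w∈
∈-bounded⇒ (suc m) (suc T) v∈ with ∈-++⁻ (map (0 Vec.∷_) (bounded m (suc T))) v∈
... | inj₁ v∈₁ with _ , w∈ , refl ← ∈-map⁻ (0 Vec.∷_) v∈₁ = ∈-bounded⇒ m (suc T) w∈
... | inj₂ v∈₂ with x Vec.∷ w , w∈ , refl ← ∈-map⁻ incrementHead v∈₂ = s≤s (∈-bounded⇒ (suc m) T w∈)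

∈-bounded⇐ : ∀ m T (v : Vec ℕ m) → Vec.sum v ≤ T → v ∈ bounded m T
∈-bounded⇐ zero    T       Vec.[]            _       = here refl
∈-bounded⇐ (suc m) zero    (zero Vec.∷ w)    w≤0     = ∈-map⁺ (0 Vec.∷_) (∈-bounded⇐ m zero w w≤0)
∈-bounded⇐ (suc m) (suc T) (zero Vec.∷ w)    w≤T     = ∈-++⁺ˡ (∈-map⁺ (0 Vec.∷_) (∈-bounded⇐ m (suc T) w w≤T))
∈-bounded⇐ (suc m) (suc T) (suc x Vec.∷ w) (s≤s v≤T) =
  ∈-++⁺ʳ (map (0 Vec.∷_) (bounded m (suc T))) (∈-map⁺ incrementHead (∈-bounded⇐ (suc m) T (x Vec.∷ w) v≤T))

bounded-unique : ∀ m T → Unique (bounded m T)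
bounded-unique zero    T       = All.[] Unique.∷ Unique.[]
bounded-unique (suc m) zero    = Unique.map⁺ VecP.∷-injectiveʳ (bounded-unique m zero)
bounded-unique (suc m) (suc T) =
  Unique.++⁺ (Unique.map⁺ VecP.∷-injectiveʳ (bounded-unique m (suc T)))
             (Unique.map⁺ incrementHead-injective (bounded-unique (suc m) T))
             disjoint
  where
  incrementHead-injective : ∀ {v w : Vec ℕ (suc m)} → incrementHead v ≡ incrementHead w → v ≡ w
  incrementHead-injective {_ Vec.∷ _} {_ Vec.∷ _} refl = refl
  disjoint : ∀ {v} → v ∈ map (0 Vec.∷_) (bounded m (suc T)) × v ∈ map incrementHead (bounded (suc m) T) → ⊥
  disjoint (v∈₁ , v∈₂) with _ , _ , refl ← ∈-map⁻ (0 Vec.∷_) v∈₁ | _ Vec.∷ _ , _ , () ← ∈-map⁻ incrementHead v∈₂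

length-bounded : ∀ m T → length (bounded m T) ≡ (T + m) C m
length-bounded zero    T       = cong (_C 0) (sym (+-identityʳ T))
length-bounded (suc m) zero    = trans (ListP.length-map (0 Vec.∷_) (bounded m zero))
                                       (trans (length-bounded m zero) (trans (nCn≡1 m) (sym (nCn≡1 (suc m)))))
length-bounded (suc m) (suc T) = begin
    length (map (0 Vec.∷_) (bounded m (suc T)) ++ map incrementHead (bounded (suc m) T))
  ≡⟨ ListP.length-++ (map (0 Vec.∷_) (bounded m (suc T))) ⟩
    length (map (0 Vec.∷_) (bounded m (suc T))) + length (map incrementHead (bounded (suc m) T))
  ≡⟨ cong₂ _+_ (ListP.length-map (0 Vec.∷_) (bounded m (suc T))) (ListP.length-map incrementHead (bounded (suc m) T)) ⟩
    length (bounded m (suc T)) + length (bounded (suc m) T)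
  ≡⟨ cong₂ _+_ (length-bounded m (suc T)) (trans (length-bounded (suc m) T) (cong (_C suc m) (+-suc T m))) ⟩
    (suc T + m) C m + (suc T + m) C suc m
  ≡⟨ nCk+nC[k+1]≡[n+1]C[k+1] (suc T + m) m ⟩
    suc (suc T + m) C suc m
  ≡⟨ cong (_C suc m) (sym (+-suc (suc T) m)) ⟩
    (suc T + suc m) C suc m
  ∎
  where open ≡-Reasoning

-- Power series as coefficient sequences: Δ F is (1 − x) F(x), shift k F is x^k F(x), and
-- conv A F is A(x) F(x)

Δ : (ℕ → ℤ) → ℕ → ℤ
Δ F zero    = F zero
Δ F (suc n) = F (suc n) ℤ.- F n

Δ^ : ℕ → (ℕ → ℤ) → ℕ → ℤ
Δ^ zero    F = F
Δ^ (suc e) F = Δ^ e (Δ F)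

conv : (ℕ → ℤ) → (ℕ → ℤ) → ℕ → ℤ
conv A F n = Σℤ≤ n (λ j → A j ℤ.* F (n ∸ j))

signedBinomial : ℕ → ℕ → ℤ
signedBinomial e j = ℤ.-1ℤ ℤ.^ j ℤ.* + (e C j)

Σℤ≤-cong : ∀ n {f g : ℕ → ℤ} → (∀ j → j ≤ n → f j ≡ g j) → Σℤ≤ n f ≡ Σℤ≤ n g
Σℤ≤-cong zero    f≗g = f≗g 0 z≤n
Σℤ≤-cong (suc n) f≗g = cong₂ ℤ._+_ (Σℤ≤-cong n (λ j j≤n → f≗g j (m≤n⇒m≤1+n j≤n))) (f≗g (suc n) ≤-refl)

Σℤ≤-suc : ∀ n (f : ℕ → ℤ) → Σℤ≤ (suc n) f ≡ f 0 ℤ.+ Σℤ≤ n (λ j → f (suc j))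
Σℤ≤-suc zero    f = refl
Σℤ≤-suc (suc n) f = trans (cong (ℤ._+ f (suc (suc n))) (Σℤ≤-suc n f)) (ℤP.+-assoc (f 0) _ _)

Σℤ≤-distrib-− : ∀ n (f g : ℕ → ℤ) → Σℤ≤ n (λ j → f j ℤ.- g j) ≡ Σℤ≤ n f ℤ.- Σℤ≤ n g
Σℤ≤-distrib-− zero    f g = refl
Σℤ≤-distrib-− (suc n) f g = trans (cong (ℤ._+ (f (suc n) ℤ.- g (suc n))) (Σℤ≤-distrib-− n f g))
                                  (interchange (Σℤ≤ n f) (Σℤ≤ n g) (f (suc n)) (g (suc n)))
  where
  interchange : ∀ a b c e → (a ℤ.- b) ℤ.+ (c ℤ.- e) ≡ (a ℤ.+ c) ℤ.- (b ℤ.+ e)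
  interchange = ℤ-Solver.solve-∀

conv-cong : ∀ {A A′ F F′ : ℕ → ℤ} → (∀ j → A j ≡ A′ j) → (∀ j → F j ≡ F′ j) →
            ∀ n → conv A F n ≡ conv A′ F′ n
conv-cong A≗A′ F≗F′ n = Σℤ≤-cong n (λ j _ → cong₂ ℤ._*_ (A≗A′ j) (F≗F′ (n ∸ j)))

conv-Δʳ : ∀ A F n → conv A (Δ F) n ≡ Δ (conv A F) n
conv-Δʳ A F zero    = refl
conv-Δʳ A F (suc m) = begin
    Σℤ≤ m (λ j → A j ℤ.* Δ F (suc m ∸ j)) ℤ.+ A (suc m) ℤ.* Δ F (m ∸ m)
  ≡⟨ cong₂ ℤ._+_ (Σℤ≤-cong m difference) (cong (λ z → A (suc m) ℤ.* Δ F z) (n∸n≡0 m)) ⟩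
    Σℤ≤ m (λ j → A j ℤ.* F (suc m ∸ j) ℤ.- A j ℤ.* F (m ∸ j)) ℤ.+ A (suc m) ℤ.* F 0
  ≡⟨ cong (ℤ._+ A (suc m) ℤ.* F 0) (Σℤ≤-distrib-− m (λ j → A j ℤ.* F (suc m ∸ j)) (λ j → A j ℤ.* F (m ∸ j))) ⟩
    (X ℤ.- Y) ℤ.+ A (suc m) ℤ.* F 0
  ≡⟨ swap X Y (A (suc m) ℤ.* F 0) ⟩
    (X ℤ.+ A (suc m) ℤ.* F 0) ℤ.- Y
  ≡⟨ cong (λ z → (X ℤ.+ A (suc m) ℤ.* F z) ℤ.- Y) (sym (n∸n≡0 m)) ⟩
    (X ℤ.+ A (suc m) ℤ.* F (m ∸ m)) ℤ.- Y
  ∎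
  where
  open ≡-Reasoning
  X Y : ℤ
  X = Σℤ≤ m (λ j → A j ℤ.* F (suc m ∸ j))
  Y = Σℤ≤ m (λ j → A j ℤ.* F (m ∸ j))
  swap : ∀ x y z → (x ℤ.- y) ℤ.+ z ≡ (x ℤ.+ z) ℤ.- y
  swap = ℤ-Solver.solve-∀
  distrib : ∀ a x y → a ℤ.* (x ℤ.- y) ≡ a ℤ.* x ℤ.- a ℤ.* y
  distrib = ℤ-Solver.solve-∀
  difference : ∀ j → j ≤ m → A j ℤ.* Δ F (suc m ∸ j) ≡ A j ℤ.* F (suc m ∸ j) ℤ.- A j ℤ.* F (m ∸ j)
  difference j j≤m rewrite +-∸-assoc 1 j≤m = distrib (A j) (F (suc (m ∸ j))) (F (m ∸ j))

conv-Δˡ : ∀ A F n → conv (Δ A) F n ≡ Δ (conv A F) n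
conv-Δˡ A F zero    = refl
conv-Δˡ A F (suc m) = begin
    Σℤ≤ (suc m) (λ j → Δ A j ℤ.* F (suc m ∸ j))
  ≡⟨ Σℤ≤-suc m (λ j → Δ A j ℤ.* F (suc m ∸ j)) ⟩
    A 0 ℤ.* F (suc m) ℤ.+ Σℤ≤ m (λ j → (A (suc j) ℤ.- A j) ℤ.* F (m ∸ j))
  ≡⟨ cong (ℤ._+_ (A 0 ℤ.* F (suc m))) (trans (Σℤ≤-cong m (λ j _ → distrib (A (suc j)) (A j) (F (m ∸ j))))
                                     (Σℤ≤-distrib-− m (λ j → A (suc j) ℤ.* F (m ∸ j)) (λ j → A j ℤ.* F (m ∸ j)))) ⟩
    A 0 ℤ.* F (suc m) ℤ.+ (Z ℤ.- Y)
  ≡⟨ assoc (A 0 ℤ.* F (suc m)) Z Y ⟩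
    (A 0 ℤ.* F (suc m) ℤ.+ Z) ℤ.- Y
  ≡⟨ cong (ℤ._- Y) (sym (Σℤ≤-suc m (λ j → A j ℤ.* F (suc m ∸ j)))) ⟩
    Σℤ≤ (suc m) (λ j → A j ℤ.* F (suc m ∸ j)) ℤ.- Y
  ∎
  where
  open ≡-Reasoning
  Z Y : ℤ
  Z = Σℤ≤ m (λ j → A (suc j) ℤ.* F (m ∸ j))
  Y = Σℤ≤ m (λ j → A j ℤ.* F (m ∸ j))
  distrib : ∀ a b x → (a ℤ.- b) ℤ.* x ≡ a ℤ.* x ℤ.- b ℤ.* x
  distrib = ℤ-Solver.solve-∀
  assoc : ∀ w z y → w ℤ.+ (z ℤ.- y) ≡ (w ℤ.+ z) ℤ.- y
  assoc = ℤ-Solver.solve-∀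

signedBinomial-suc : ∀ e j → signedBinomial (suc e) j ≡ Δ (signedBinomial e) j
signedBinomial-suc e zero    = refl
signedBinomial-suc e (suc j) = begin
    ℤ.-1ℤ ℤ.* u ℤ.* + (suc e C suc j)
  ≡⟨ cong (λ z → ℤ.-1ℤ ℤ.* u ℤ.* + z) (sym (nCk+nC[k+1]≡[n+1]C[k+1] e j)) ⟩
    ℤ.-1ℤ ℤ.* u ℤ.* + (e C j + e C suc j)
  ≡⟨ cong (λ z → ℤ.-1ℤ ℤ.* u ℤ.* z) (ℤP.pos-+ (e C j) (e C suc j)) ⟩
    ℤ.-1ℤ ℤ.* u ℤ.* (+ (e C j) ℤ.+ + (e C suc j))
  ≡⟨ pascal u (+ (e C j)) (+ (e C suc j)) ⟩
    ℤ.-1ℤ ℤ.* u ℤ.* + (e C suc j) ℤ.- u ℤ.* + (e C j)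
  ∎
  where
  open ≡-Reasoning
  u : ℤ
  u = ℤ.-1ℤ ℤ.^ j
  pascal : ∀ u a b → ℤ.-1ℤ ℤ.* u ℤ.* (a ℤ.+ b) ≡ ℤ.-1ℤ ℤ.* u ℤ.* b ℤ.- u ℤ.* a
  pascal = ℤ-Solver.solve-∀

Σℤ≤-signedBinomial-zero : ∀ (F : ℕ → ℤ) n m → Σℤ≤ m (λ j → signedBinomial 0 j ℤ.* F (n ∸ j)) ≡ F n
Σℤ≤-signedBinomial-zero F n zero    = ℤP.*-identityˡ (F n)
Σℤ≤-signedBinomial-zero F n (suc m) =
  trans (cong₂ ℤ._+_ (Σℤ≤-signedBinomial-zero F n m)
                   (trans (cong (ℤ._* F (n ∸ suc m)) (ℤP.*-zeroʳ (ℤ.-1ℤ ℤ.^ suc m))) (ℤP.*-zeroˡ (F (n ∸ suc m)))))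
        (ℤP.+-identityʳ (F n))

conv-signedBinomial : ∀ e F n → conv (signedBinomial e) F n ≡ Δ^ e F n
conv-signedBinomial zero    F n = Σℤ≤-signedBinomial-zero F n n
conv-signedBinomial (suc e) F n = begin
  conv (signedBinomial (suc e)) F n  ≡⟨ conv-cong {F = F} (signedBinomial-suc e) (λ _ → refl) n ⟩
  conv (Δ (signedBinomial e)) F n    ≡⟨ conv-Δˡ (signedBinomial e) F n ⟩
  Δ (conv (signedBinomial e) F) n    ≡⟨ conv-Δʳ (signedBinomial e) F n ⟨
  conv (signedBinomial e) (Δ F) n    ≡⟨ conv-signedBinomial e (Δ F) n ⟩
  Δ^ e (Δ F) n                       ∎
  where open ≡-Reasoning

Δ-cong : ∀ {F G : ℕ → ℤ} → (∀ m → F m ≡ G m) → ∀ m → Δ F m ≡ Δ G m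
Δ-cong F≗G zero    = F≗G zero
Δ-cong F≗G (suc m) = cong₂ ℤ._-_ (F≗G (suc m)) (F≗G m)

Δ^-cong : ∀ e {F G : ℕ → ℤ} → (∀ m → F m ≡ G m) → ∀ m → Δ^ e F m ≡ Δ^ e G m
Δ^-cong zero    F≗G = F≗G
Δ^-cong (suc e) F≗G = Δ^-cong e (Δ-cong F≗G)

Δ^-suc : ∀ e F m → Δ^ (suc e) F m ≡ Δ (Δ^ e F) m
Δ^-suc zero    F m = refl
Δ^-suc (suc e) F m = Δ^-suc e (Δ F) m

Δ-+ : ∀ F G m → Δ (λ x → F x ℤ.+ G x) m ≡ Δ F m ℤ.+ Δ G m
Δ-+ F G zero    = refl
Δ-+ F G (suc m) = interchange (F (suc m)) (G (suc m)) (F m) (G m)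
  where
  interchange : ∀ a b c e → (a ℤ.+ b) ℤ.- (c ℤ.+ e) ≡ (a ℤ.- c) ℤ.+ (b ℤ.- e)
  interchange = ℤ-Solver.solve-∀

Δ-* : ∀ c F m → Δ (λ x → c ℤ.* F x) m ≡ c ℤ.* Δ F m
Δ-* c F zero    = refl
Δ-* c F (suc m) = distrib c (F (suc m)) (F m)
  where
  distrib : ∀ c a b → c ℤ.* a ℤ.- c ℤ.* b ≡ c ℤ.* (a ℤ.- b)
  distrib = ℤ-Solver.solve-∀

Δ^-+ : ∀ e F G m → Δ^ e (λ x → F x ℤ.+ G x) m ≡ Δ^ e F m ℤ.+ Δ^ e G m
Δ^-+ zero    F G m = refl
Δ^-+ (suc e) F G m = trans (Δ^-cong e (Δ-+ F G) m) (Δ^-+ e (Δ F) (Δ G) m)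

Δ^-* : ∀ e c F m → Δ^ e (λ x → c ℤ.* F x) m ≡ c ℤ.* Δ^ e F m
Δ^-* zero    c F m = refl
Δ^-* (suc e) c F m = trans (Δ^-cong e (Δ-* c F) m) (Δ^-* e c (Δ F) m)

δ : ℕ → ℕ → ℤ
δ k m = if m ≡ᵇ k then + 1 else + 0

binomial : ℕ → ℕ → ℤ
binomial e m = + ((m + e) C e)

Δ-binomial : ∀ e m → Δ (binomial (suc e)) m ≡ binomial e m
Δ-binomial e zero    = cong +_ (trans (nCn≡1 (suc e)) (sym (nCn≡1 e)))
Δ-binomial e (suc m) = begin
    + ((suc m + suc e) C suc e) ℤ.- + ((m + suc e) C suc e)
  ≡⟨ cong₂ (λ x y → + (x C suc e) ℤ.- + (y C suc e)) (+-suc (suc m) e) (+-suc m e) ⟩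
    + (suc n C suc e) ℤ.- + (n C suc e)
  ≡⟨ cong (λ z → + z ℤ.- + (n C suc e)) (sym (nCk+nC[k+1]≡[n+1]C[k+1] n e)) ⟩
    + (n C e + n C suc e) ℤ.- + (n C suc e)
  ≡⟨ cong (ℤ._- + (n C suc e)) (ℤP.pos-+ (n C e) (n C suc e)) ⟩
    (+ (n C e) ℤ.+ + (n C suc e)) ℤ.- + (n C suc e)
  ≡⟨ cancel (+ (n C e)) (+ (n C suc e)) ⟩
    + (n C e)
  ∎
  where
  open ≡-Reasoning
  n : ℕ
  n = suc m + e
  cancel : ∀ a b → (a ℤ.+ b) ℤ.- b ≡ a
  cancel = ℤ-Solver.solve-∀

Δ-binomial-zero : ∀ m → Δ (binomial 0) m ≡ δ 0 m
Δ-binomial-zero zero    = refl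
Δ-binomial-zero (suc m) = refl

Δ^-binomial : ∀ e m → Δ^ (suc e) (binomial e) m ≡ δ 0 m
Δ^-binomial e m = trans (Δ^-suc e (binomial e) m) (trans (Δ-cong (peel e) m) (Δ-binomial-zero m))
  where
  peel : ∀ e m → Δ^ e (binomial e) m ≡ binomial 0 m
  peel zero    m = refl
  peel (suc e) m = trans (Δ^-cong e (Δ-binomial e) m) (peel e m)

shift : ℕ → (ℕ → ℤ) → ℕ → ℤ
shift k F m with k ≤? m
... | yes _ = F (m ∸ k)
... | no  _ = 0ℤ

shift-cong : ∀ k {F G : ℕ → ℤ} → (∀ m → F m ≡ G m) → ∀ m → shift k F m ≡ shift k G m
shift-cong k F≗G m with k ≤? m
... | yes _ = F≗G (m ∸ k)
... | no  _ = refl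

Δ-shift : ∀ k F m → Δ (shift k F) m ≡ shift k (Δ F) m
Δ-shift k F zero with k ≤? 0
... | yes k≤0 rewrite n≤0⇒n≡0 k≤0 = refl
... | no  _   = refl
Δ-shift k F (suc m) with k ≤? suc m | k ≤? m
... | yes _   | yes k≤m rewrite +-∸-assoc 1 k≤m = refl
... | yes k≤1+m | no k≰m rewrite ≤-antisym k≤1+m (≰⇒> k≰m) | n∸n≡0 (suc m) = ℤP.+-identityʳ (F 0)
... | no k≰1+m | yes k≤m = contradiction (m≤n⇒m≤1+n k≤m) k≰1+m
... | no  _   | no  _   = refl

Δ^-shift : ∀ e k F m → Δ^ e (shift k F) m ≡ shift k (Δ^ e F) m
Δ^-shift zero    k F m = refl
Δ^-shift (suc e) k F m = trans (Δ^-cong e (Δ-shift k F) m) (Δ^-shift e k (Δ F) m)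

∸≡ᵇ0≡≡ᵇ : ∀ {k m} → k ≤ m → (m ∸ k ≡ᵇ 0) ≡ (m ≡ᵇ k)
∸≡ᵇ0≡≡ᵇ z≤n       = refl
∸≡ᵇ0≡≡ᵇ (s≤s k≤m) = ∸≡ᵇ0≡≡ᵇ k≤m

shift-δ : ∀ k m → shift k (δ 0) m ≡ δ k m
shift-δ k m with k ≤? m
... | yes k≤m = cong (if_then + 1 else + 0) (∸≡ᵇ0≡≡ᵇ k≤m)
... | no  k≰m with m ≡ᵇ k in m≡ᵇk
...   | false = refl
...   | true  = contradiction (≤-reflexive (sym (≡ᵇ⇒≡ m k (subst T (sym m≡ᵇk) tt)))) k≰m

hstar-binomial+shifted : ∀ d k s (F : ℕ → ℤ) → (∀ m → F m ≡ binomial d m ℤ.+ + s ℤ.* shift k (binomial d) m) →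
                         ∀ n → hstarCoeff d F n ≡ target s k n
hstar-binomial+shifted d k s F F≡ n = begin
    hstarCoeff d F n
  ≡⟨ conv-cong {A = signedBinomial (suc d)} (λ _ → refl) F≡ n ⟩
    conv (signedBinomial (suc d)) G n
  ≡⟨ conv-signedBinomial (suc d) G n ⟩
    Δ^ (suc d) G n
  ≡⟨ Δ^-+ (suc d) (binomial d) (λ m → + s ℤ.* shift k (binomial d) m) n ⟩
    Δ^ (suc d) (binomial d) n ℤ.+ Δ^ (suc d) (λ m → + s ℤ.* shift k (binomial d) m) n
  ≡⟨ cong₂ ℤ._+_ (Δ^-binomial d n) (trans (Δ^-* (suc d) (+ s) (shift k (binomial d)) n) (cong (ℤ._*_ (+ s)) shifted-binomial)) ⟩
    δ 0 n ℤ.+ + s ℤ.* δ k n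
  ≡⟨ cong (ℤ._+_ (δ 0 n)) (scale (n ≡ᵇ k)) ⟩
    target s k n
  ∎
  where
  open ≡-Reasoning
  G : ℕ → ℤ
  G m = binomial d m ℤ.+ + s ℤ.* shift k (binomial d) m
  shifted-binomial : Δ^ (suc d) (shift k (binomial d)) n ≡ δ k n
  shifted-binomial = trans (Δ^-shift (suc d) k (binomial d) n) (trans (shift-cong k (Δ^-binomial d) n) (shift-δ k n))
  scale : ∀ β → + s ℤ.* (if β then + 1 else + 0) ≡ (if β then + s else + 0)
  scale true  = ℤP.*-identityʳ (+ s)
  scale false = ℤP.*-zeroʳ (+ s)

-- Lattice points of tM

-- Coordinates are indexed by Fin d, d = suc d'; the inner ones are the paper's x₁ … x_{d−1}, carried
-- by e₁ … e_{d−1}, and last is x_d. Among the inner coordinates of ω there are d' ∸ b ones and b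
-- entries s.
module Polytope (s d' b : ℕ) where

  d k S : ℕ
  d = suc d'
  k = suc b
  S = suc s

  last : Fin d
  last = fromℕ d'

  inner : Fin d → Bool
  inner i = toℕ i <ᵇ d'

  onInner : {A : Set} → A → (Fin d → A) → Fin d → A
  onInner 0# f i = if inner i then f i else 0#

  inner-last : inner last ≡ false
  inner-last rewrite FinP.toℕ-fromℕ d' = n≤m⇒m<ᵇn≡false {d'} ≤-refl

  ωₙ : Fin d → ℕ
  ωₙ i = if toℕ i <ᵇ d' ∸ b then 1 else if inner i then s else S

  ω-coord≡ωₙ : ∀ i → ω-coord s d k i ≡ + ωₙ i
  ω-coord≡ωₙ i with toℕ i <ᵇ d' ∸ b
  ... | true = refl
  ... | false with inner i
  ...   | true = refl
  ...   | false = refl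

  ωₙ-last : ωₙ last ≡ S
  ωₙ-last rewrite inner-last | FinP.toℕ-fromℕ d' | n≤m⇒m<ᵇn≡false {d'} {d' ∸ b} (m∸n≤m d' b) = refl

  last-or-inner : ∀ i → i ≡ last ⊎ inner i ≡ true
  last-or-inner i with inner i in eq
  ... | true  = inj₂ refl
  ... | false = inj₁ (FinP.toℕ-injective (trans (≤-antisym (≤-pred (FinP.toℕ<n i)) (≮⇒≥ i≮d')) (sym (FinP.toℕ-fromℕ d'))))
    where
    i≮d' : ¬ (toℕ i < d')
    i≮d' i<d' = subst T eq (<⇒<ᵇ i<d')

  combination : (Fin (suc d) → ℚ) → Fin d → ℚ
  combination λs i = Σℚ (suc d) (λ j → λs j ℚ.* ℤ→ℚ (lookup (M-vertices s d k j) i))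

  combination≡inner+apex : ∀ λs i → combination λs i ≡ onInner 0ℚ (λs ∘ suc) i ℚ.+ λs (suc last) ℚ.* ι (+ ωₙ i)
  combination≡inner+apex λs i = begin
      F zero ℚ.+ Σℚ d (F ∘ suc)
    ≡⟨ cong₂ ℚ._+_ origin (Σℚ≡sum d (F ∘ suc)) ⟩
      0ℚ ℚ.+ ℚΣ.sum (F ∘ suc)
    ≡⟨ trans (ℚP.+-identityˡ _) (sum-split-last ℚP.+-0-monoid d' (F ∘ suc)) ⟩
      ℚΣ.sum (onInner 0ℚ (F ∘ suc)) ℚ.+ F (suc last)
    ≡⟨ cong₂ ℚ._+_ (trans (ℚΣ.sum-cong-≗ unit-vectors) (sum-indicator ℚP.+-0-monoid d (onInner 0ℚ (λs ∘ suc)) i)) apex ⟩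
      onInner 0ℚ (λs ∘ suc) i ℚ.+ λs (suc last) ℚ.* ι (+ ωₙ i) ∎
    where
    open ≡-Reasoning
    F : Fin (suc d) → ℚ
    F j = λs j ℚ.* ℤ→ℚ (lookup (M-vertices s d k j) i)
    origin : F zero ≡ 0ℚ
    origin rewrite VecP.lookup-replicate i (+ 0) = ℚP.*-zeroʳ (λs zero)
    apex : F (suc last) ≡ λs (suc last) ℚ.* ι (+ ωₙ i)
    apex rewrite inner-last | VecP.lookup∘tabulate (ω-coord s d k) i | ω-coord≡ωₙ i =
      cong (λs (suc last) ℚ.*_) (ℤ→ℚ≡ι (+ ωₙ i))
    unit-vectors : ∀ j → onInner 0ℚ (F ∘ suc) j ≡ (if toℕ i ≡ᵇ toℕ j then onInner 0ℚ (λs ∘ suc) j else 0ℚ)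
    unit-vectors j with inner j
    ... | false = sym (if-eta (toℕ i ≡ᵇ toℕ j))
    ... | true rewrite VecP.lookup∘tabulate (λ i → if toℕ i ≡ᵇ toℕ j then + 1 else + 0) i with toℕ i ≡ᵇ toℕ j
    ...   | true  = ℚP.*-identityʳ (λs (suc j))
    ...   | false = ℚP.*-zeroʳ (λs (suc j))

  σ 1/σ : ℚ
  σ = ι (+ S)
  1/σ = ℚ.1/ σ

  σ≥0 : 0ℚ ℚ.≤ σ
  σ≥0 = ℚP.nonNegative⁻¹ σ

  σ*q*1/σ≡q : ∀ q → (σ ℚ.* q) ℚ.* 1/σ ≡ q
  σ*q*1/σ≡q q = begin
      (σ ℚ.* q) ℚ.* 1/σ ≡⟨ swap σ q 1/σ ⟩
      (σ ℚ.* 1/σ) ℚ.* q ≡⟨ cong (ℚ._* q) (ℚP.*-inverseʳ σ) ⟩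
      1ℚ ℚ.* q          ≡⟨ ℚP.*-identityˡ q ⟩
      q                 ∎
    where
    open ≡-Reasoning
    swap : ∀ a b c → (a ℚ.* b) ℚ.* c ≡ (a ℚ.* c) ℚ.* b
    swap = RingSolver.solve-∀ ℚ-ring

  ι-homo-scaled-diff : ∀ y w c → ι (+ S ℤ.* y ℤ.- + w ℤ.* c) ≡ σ ℚ.* ι y ℚ.- ι (+ w) ℚ.* ι c
  ι-homo-scaled-diff y w c = trans (ι-homo-− (+ S ℤ.* y) (+ w ℤ.* c)) (cong₂ ℚ._-_ (ι-homo-* (+ S) y) (ι-homo-* (+ w) c))

  vertexNum : Vec ℤ d → Fin d → ℤ
  vertexNum x i = if inner i then + S ℤ.* lookup x i ℤ.- + ωₙ i ℤ.* lookup x last else lookup x last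

  -- S times the barycentric coordinates of x in tM, for the vertices 0, e_{i+1} (inner i) and ω.
  baryNum : ℕ → Vec ℤ d → Fin (suc d) → ℤ
  baryNum t x zero    = + S ℤ.* + t ℤ.- ℤΣ.sum (vertexNum x)
  baryNum t x (suc i) = vertexNum x i

  bary : ℕ → Vec ℤ d → Fin (suc d) → ℚ
  bary t x j = ι (baryNum t x j) ℚ.* 1/σ

  bary-sum : ∀ t x → Σℚ (suc d) (bary t x) ≡ ℤ→ℚ (+ t)
  bary-sum t x = begin
      Σℚ (suc d) (bary t x)                   ≡⟨ Σℚ≡sum (suc d) (bary t x) ⟩
      ℚΣ.sum (bary t x)                       ≡⟨ ℚΣ.*-distribʳ-sum 1/σ (ι ∘ baryNum t x) ⟨
      ℚΣ.sum (ι ∘ baryNum t x) ℚ.* 1/σ        ≡⟨ cong (ℚ._* 1/σ) (ι-homo-sum (suc d) (baryNum t x)) ⟨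
      ι (ℤΣ.sum (baryNum t x)) ℚ.* 1/σ        ≡⟨ cong (λ z → ι z ℚ.* 1/σ) (minus-plus (+ S ℤ.* + t) (ℤΣ.sum (vertexNum x))) ⟩
      ι (+ S ℤ.* + t) ℚ.* 1/σ                 ≡⟨ cong (ℚ._* 1/σ) (ι-homo-* (+ S) (+ t)) ⟩
      (σ ℚ.* ι (+ t)) ℚ.* 1/σ                 ≡⟨ σ*q*1/σ≡q (ι (+ t)) ⟩
      ι (+ t)                                 ≡⟨ ℤ→ℚ≡ι (+ t) ⟨
      ℤ→ℚ (+ t)                               ∎
    where
    open ≡-Reasoning
    minus-plus : ∀ a n → (a ℤ.- n) ℤ.+ n ≡ a
    minus-plus = ℤ-Solver.solve-∀

  bary-coords : ∀ t x i → ℤ→ℚ (lookup x i) ≡ combination (bary t x) i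
  bary-coords t x i = begin
      ℤ→ℚ (lookup x i)                                                            ≡⟨ ℤ→ℚ≡ι (lookup x i) ⟩
      ι (lookup x i)                                                              ≡⟨ coords (last-or-inner i) ⟨
      onInner 0ℚ (bary t x ∘ suc) i ℚ.+ bary t x (suc last) ℚ.* ι (+ ωₙ i)        ≡⟨ combination≡inner+apex (bary t x) i ⟨
      combination (bary t x) i                                                    ∎
    where
    open ≡-Reasoning
    ιc : ℚ
    ιc = ι (lookup x last)
    last-coord : ∀ a c u → (c ℚ.* u) ℚ.* a ≡ (a ℚ.* c) ℚ.* u
    last-coord = RingSolver.solve-∀ ℚ-ring
    inner-coord : ∀ a y w c u → (a ℚ.* y ℚ.- w ℚ.* c) ℚ.* u ℚ.+ (c ℚ.* u) ℚ.* w ≡ (a ℚ.* y) ℚ.* u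
    inner-coord = RingSolver.solve-∀ ℚ-ring
    coords : i ≡ last ⊎ inner i ≡ true →
             onInner 0ℚ (bary t x ∘ suc) i ℚ.+ bary t x (suc last) ℚ.* ι (+ ωₙ i) ≡ ι (lookup x i)
    coords (inj₁ refl) = begin
      onInner 0ℚ (bary t x ∘ suc) last ℚ.+ bary t x (suc last) ℚ.* ι (+ ωₙ last)
        ≡⟨ cong₂ (λ m w → m ℚ.+ ι (vertexNum x last) ℚ.* 1/σ ℚ.* ι (+ w)) (if-cong inner-last) ωₙ-last ⟩
      0ℚ ℚ.+ ι (vertexNum x last) ℚ.* 1/σ ℚ.* σ
        ≡⟨ trans (ℚP.+-identityˡ _) (cong (λ v → ι v ℚ.* 1/σ ℚ.* σ) (if-cong inner-last)) ⟩
      ιc ℚ.* 1/σ ℚ.* σ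
        ≡⟨ trans (last-coord σ ιc 1/σ) (σ*q*1/σ≡q ιc) ⟩
      ιc ∎
    coords (inj₂ inner-i) = begin
      onInner 0ℚ (bary t x ∘ suc) i ℚ.+ bary t x (suc last) ℚ.* ι (+ ωₙ i)
        ≡⟨ cong₂ (λ m v → m ℚ.+ ι v ℚ.* 1/σ ℚ.* ι (+ ωₙ i))
                 (trans (if-cong inner-i) (cong (λ v → ι v ℚ.* 1/σ) (if-cong inner-i)))
                 (if-cong inner-last) ⟩
      ι (+ S ℤ.* lookup x i ℤ.- + ωₙ i ℤ.* lookup x last) ℚ.* 1/σ ℚ.+ ιc ℚ.* 1/σ ℚ.* ι (+ ωₙ i)
        ≡⟨ cong (λ v → v ℚ.* 1/σ ℚ.+ ιc ℚ.* 1/σ ℚ.* ι (+ ωₙ i)) (ι-homo-scaled-diff (lookup x i) (ωₙ i) (lookup x last)) ⟩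
      (σ ℚ.* ι (lookup x i) ℚ.- ι (+ ωₙ i) ℚ.* ιc) ℚ.* 1/σ ℚ.+ ιc ℚ.* 1/σ ℚ.* ι (+ ωₙ i)
        ≡⟨ trans (inner-coord σ (ι (lookup x i)) (ι (+ ωₙ i)) ιc 1/σ) (σ*q*1/σ≡q (ι (lookup x i))) ⟩
      ι (lookup x i) ∎

  coords⇒σλ≡vertexNum : ∀ x λs → (∀ i → ℤ→ℚ (lookup x i) ≡ combination λs i) →
                        ∀ i → σ ℚ.* λs (suc i) ≡ ι (vertexNum x i)
  coords⇒σλ≡vertexNum x λs coords i = by-position (last-or-inner i)
    where
    open ≡-Reasoning
    coords′ : ∀ i → ι (lookup x i) ≡ onInner 0ℚ (λs ∘ suc) i ℚ.+ λs (suc last) ℚ.* ι (+ ωₙ i)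
    coords′ i = trans (sym (ℤ→ℚ≡ι (lookup x i))) (trans (coords i) (combination≡inner+apex λs i))
    apex : σ ℚ.* λs (suc last) ≡ ι (lookup x last)
    apex = begin
      σ ℚ.* λs (suc last)                                                ≡⟨ ℚP.*-comm σ (λs (suc last)) ⟩
      λs (suc last) ℚ.* σ                                                ≡⟨ ℚP.+-identityˡ _ ⟨
      0ℚ ℚ.+ λs (suc last) ℚ.* σ
        ≡⟨ cong₂ (λ m w → m ℚ.+ λs (suc last) ℚ.* ι (+ w)) (if-cong inner-last) ωₙ-last ⟨
      onInner 0ℚ (λs ∘ suc) last ℚ.+ λs (suc last) ℚ.* ι (+ ωₙ last)     ≡⟨ coords′ last ⟨
      ι (lookup x last)                                                  ∎
    rearrange : ∀ a l m w → a ℚ.* l ≡ a ℚ.* (l ℚ.+ m ℚ.* w) ℚ.- w ℚ.* (a ℚ.* m)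
    rearrange = RingSolver.solve-∀ ℚ-ring
    by-position : i ≡ last ⊎ inner i ≡ true → σ ℚ.* λs (suc i) ≡ ι (vertexNum x i)
    by-position (inj₁ refl) = trans apex (cong ι (sym (if-cong inner-last)))
    by-position (inj₂ inner-i) = begin
      σ ℚ.* λs (suc i)
        ≡⟨ rearrange σ (λs (suc i)) (λs (suc last)) (ι (+ ωₙ i)) ⟩
      σ ℚ.* (λs (suc i) ℚ.+ λs (suc last) ℚ.* ι (+ ωₙ i)) ℚ.- ι (+ ωₙ i) ℚ.* (σ ℚ.* λs (suc last))
        ≡⟨ cong₂ (λ y c → σ ℚ.* y ℚ.- ι (+ ωₙ i) ℚ.* c)
                 (trans (cong (ℚ._+ λs (suc last) ℚ.* ι (+ ωₙ i)) (sym (if-cong inner-i))) (sym (coords′ i))) apex ⟩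
      σ ℚ.* ι (lookup x i) ℚ.- ι (+ ωₙ i) ℚ.* ι (lookup x last)
        ≡⟨ ι-homo-scaled-diff (lookup x i) (ωₙ i) (lookup x last) ⟨
      ι (+ S ℤ.* lookup x i ℤ.- + ωₙ i ℤ.* lookup x last)
        ≡⟨ cong ι (if-cong inner-i) ⟨
      ι (vertexNum x i) ∎

  represents⇒σλ≡baryNum : ∀ t x λs → Σℚ (suc d) λs ≡ ℤ→ℚ (+ t) →
                          (∀ i → ℤ→ℚ (lookup x i) ≡ combination λs i) →
                          ∀ j → σ ℚ.* λs j ≡ ι (baryNum t x j)
  represents⇒σλ≡baryNum t x λs sum≡t coords (suc i) = coords⇒σλ≡vertexNum x λs coords i
  represents⇒σλ≡baryNum t x λs sum≡t coords zero    = begin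
      σ ℚ.* λs zero                                               ≡⟨ rearrange σ (λs zero) (Σℚ d (λs ∘ suc)) ⟩
      σ ℚ.* Σℚ (suc d) λs ℚ.- σ ℚ.* Σℚ d (λs ∘ suc)
        ≡⟨ cong₂ (λ T Λ → σ ℚ.* T ℚ.- Λ) (trans sum≡t (ℤ→ℚ≡ι (+ t))) σΛ≡ ⟩
      σ ℚ.* ι (+ t) ℚ.- ι (ℤΣ.sum (vertexNum x))
        ≡⟨ cong (ℚ._- ι (ℤΣ.sum (vertexNum x))) (ι-homo-* (+ S) (+ t)) ⟨
      ι (+ S ℤ.* + t) ℚ.- ι (ℤΣ.sum (vertexNum x))                 ≡⟨ ι-homo-− (+ S ℤ.* + t) (ℤΣ.sum (vertexNum x)) ⟨
      ι (baryNum t x zero)                                         ∎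
    where
    open ≡-Reasoning
    rearrange : ∀ a l m → a ℚ.* l ≡ a ℚ.* (l ℚ.+ m) ℚ.- a ℚ.* m
    rearrange = RingSolver.solve-∀ ℚ-ring
    σΛ≡ : σ ℚ.* Σℚ d (λs ∘ suc) ≡ ι (ℤΣ.sum (vertexNum x))
    σΛ≡ = begin
      σ ℚ.* Σℚ d (λs ∘ suc)              ≡⟨ cong (σ ℚ.*_) (Σℚ≡sum d (λs ∘ suc)) ⟩
      σ ℚ.* ℚΣ.sum (λs ∘ suc)            ≡⟨ ℚΣ.*-distribˡ-sum σ (λs ∘ suc) ⟩
      ℚΣ.sum (λ i → σ ℚ.* λs (suc i))    ≡⟨ ℚΣ.sum-cong-≗ (coords⇒σλ≡vertexNum x λs coords) ⟩
      ℚΣ.sum (ι ∘ vertexNum x)           ≡⟨ ι-homo-sum d (vertexNum x) ⟨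
      ι (ℤΣ.sum (vertexNum x))           ∎

  inDilate⇔baryNum≥0 : ∀ t x → InDilate d (suc d) (M-vertices s d k) t x ⇔ (∀ j → 0ℤ ℤ.≤ baryNum t x j)
  inDilate⇔baryNum≥0 t x = mk⇔ to from
    where
    to : InDilate d (suc d) (M-vertices s d k) t x → ∀ j → 0ℤ ℤ.≤ baryNum t x j
    to (λs , λs≥0 , sum≡t , coords) j =
      ι-cancel-≤ (subst (0ℚ ℚ.≤_) (represents⇒σλ≡baryNum t x λs sum≡t coords j) (*-nonNeg σ≥0 (λs≥0 j)))
    from : (∀ j → 0ℤ ℤ.≤ baryNum t x j) → InDilate d (suc d) (M-vertices s d k) t x
    from num≥0 = bary t x , (λ j → *-nonNeg (ι-mono-≤ (num≥0 j)) (ℚP.nonNegative⁻¹ 1/σ)) , bary-sum t x , bary-coords t x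

  innerSum : (Fin d → ℕ) → ℕ
  innerSum f = ℕΣ.sum (onInner 0 f)

  innerSum-cong : ∀ {f g} → (∀ i → f i ≡ g i) → innerSum f ≡ innerSum g
  innerSum-cong f≗g = ℕΣ.sum-cong-≗ (λ i → cong (if inner i then_else 0) (f≗g i))

  innerSum-onInner : ∀ f → innerSum (onInner 0 f) ≡ innerSum f
  innerSum-onInner f = ℕΣ.sum-cong-≗ (λ i → if-idem-then (inner i) {f i} {0})

  innerSum-* : ∀ m f → innerSum (λ i → m * f i) ≡ m * innerSum f
  innerSum-* m f = trans (ℕΣ.sum-cong-≗ pointwise) (sym (ℕΣ.*-distribˡ-sum m (onInner 0 f)))
    where
    pointwise : ∀ i → onInner 0 (λ i → m * f i) i ≡ m * onInner 0 f i
    pointwise i with inner i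
    ... | true  = refl
    ... | false = sym (*-zeroʳ m)

  innerSum-+ : ∀ f g → innerSum (λ i → f i + g i) ≡ innerSum f + innerSum g
  innerSum-+ f g = trans (ℕΣ.sum-cong-≗ pointwise) (ℕΣ.∑-distrib-+ (onInner 0 f) (onInner 0 g))
    where
    pointwise : ∀ i → onInner 0 (λ i → f i + g i) i ≡ onInner 0 f i + onInner 0 g i
    pointwise i with inner i
    ... | true  = refl
    ... | false = refl

  sum≡innerSum+last : ∀ f → ℕΣ.sum f ≡ innerSum f + f last
  sum≡innerSum+last = sum-split-last +-0-monoid d'

  vertexNum-pos : ∀ n i → vertexNum (Vec.map +_ n) i ≡
                + (if inner i then S * lookup n i else lookup n last) ℤ.- + onInner 0 (λ i → ωₙ i * lookup n last) i
  vertexNum-pos n i = trans (cong₂ (λ y c → if inner i then + S ℤ.* y ℤ.- + ωₙ i ℤ.* c else c)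
                                 (VecP.lookup-map i +_ n) (VecP.lookup-map last +_ n))
                          (by-cases (inner i))
    where
    by-cases : ∀ β → (if β then + S ℤ.* + lookup n i ℤ.- + ωₙ i ℤ.* + lookup n last else + lookup n last) ≡
                     + (if β then S * lookup n i else lookup n last) ℤ.- + (if β then ωₙ i * lookup n last else 0)
    by-cases true  = sym (cong₂ ℤ._-_ (ℤP.pos-* S (lookup n i)) (ℤP.pos-* (ωₙ i) (lookup n last)))
    by-cases false = sym (ℤP.+-identityʳ (+ lookup n last))

  sum-vertexNum-pos : ∀ n → ℤΣ.sum (vertexNum (Vec.map +_ n)) ≡
                    + (S * innerSum (lookup n) + lookup n last) ℤ.- + (lookup n last * innerSum ωₙ)
  sum-vertexNum-pos n = begin
      ℤΣ.sum (vertexNum (Vec.map +_ n))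
    ≡⟨ ℤΣ.sum-cong-≗ (vertexNum-pos n) ⟩
      ℤΣ.sum (λ i → + P i ℤ.- + onInner 0 (λ i → ωₙ i * c) i)
    ≡⟨ sum-pos-minus-pos d P (onInner 0 (λ i → ωₙ i * c)) ⟩
      + ℕΣ.sum P ℤ.- + innerSum (λ i → ωₙ i * c)
    ≡⟨ cong₂ (λ p q → + p ℤ.- + q) sum-P (trans (innerSum-cong (λ i → *-comm (ωₙ i) c)) (innerSum-* c ωₙ)) ⟩
      + (S * innerSum (lookup n) + c) ℤ.- + (c * innerSum ωₙ)
    ∎
    where
    open ≡-Reasoning
    c : ℕ
    c = lookup n last
    P : Fin d → ℕ
    P i = if inner i then S * lookup n i else c
    inner-P : ∀ i → onInner 0 P i ≡ onInner 0 (λ i → S * lookup n i) i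
    inner-P i with inner i
    ... | true  = refl
    ... | false = refl
    sum-P : ℕΣ.sum P ≡ S * innerSum (lookup n) + c
    sum-P = begin
      ℕΣ.sum P                                    ≡⟨ sum≡innerSum+last P ⟩
      innerSum P + P last                         ≡⟨ cong₂ _+_ (ℕΣ.sum-cong-≗ inner-P) (if-cong inner-last) ⟩
      innerSum (λ i → S * lookup n i) + c         ≡⟨ cong (_+ c) (innerSum-* S (lookup n)) ⟩
      S * innerSum (lookup n) + c                 ∎

  Admissible : ℕ → Vec ℕ d → Set
  Admissible t n = (∀ i → inner i ≡ true → ωₙ i * lookup n last ≤ S * lookup n i)
                 × (S * innerSum (lookup n) + lookup n last ≤ S * t + lookup n last * innerSum ωₙ)

  baryNum-pos-zero : ∀ t n → baryNum t (Vec.map +_ n) zero ≡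
                   + (S * t + lookup n last * innerSum ωₙ) ℤ.- + (S * innerSum (lookup n) + lookup n last)
  baryNum-pos-zero t n = begin
      + S ℤ.* + t ℤ.- ℤΣ.sum (vertexNum (Vec.map +_ n))
    ≡⟨ cong₂ (λ a v → a ℤ.- v) (sym (ℤP.pos-* S t)) (sum-vertexNum-pos n) ⟩
      + (S * t) ℤ.- (+ A ℤ.- + B)
    ≡⟨ minus-minus (+ (S * t)) (+ A) (+ B) ⟩
      (+ (S * t) ℤ.+ + B) ℤ.- + A
    ≡⟨ cong (ℤ._- + A) (ℤP.pos-+ (S * t) B) ⟨
      + (S * t + B) ℤ.- + A
    ∎
    where
    open ≡-Reasoning
    A B : ℕ
    A = S * innerSum (lookup n) + lookup n last
    B = lookup n last * innerSum ωₙ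
    minus-minus : ∀ a p q → a ℤ.- (p ℤ.- q) ≡ (a ℤ.+ q) ℤ.- p
    minus-minus = ℤ-Solver.solve-∀

  baryNum-pos≥0⇔admissible : ∀ t n → (∀ j → 0ℤ ℤ.≤ baryNum t (Vec.map +_ n) j) ⇔ Admissible t n
  baryNum-pos≥0⇔admissible t n = mk⇔ to from
    where
    c : ℕ
    c = lookup n last
    P Q : Fin d → ℕ
    P i = if inner i then S * lookup n i else c
    Q = onInner 0 (λ i → ωₙ i * c)
    vertex≥0⇔ : ∀ i → 0ℤ ℤ.≤ vertexNum (Vec.map +_ n) i ⇔ Q i ≤ P i
    vertex≥0⇔ i = subst (λ v → 0ℤ ℤ.≤ v ⇔ Q i ≤ P i) (sym (vertexNum-pos n i)) (0≤+m-+n⇔n≤m (P i) (Q i))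
    A B : ℕ
    A = S * t + c * innerSum ωₙ
    B = S * innerSum (lookup n) + c
    origin≥0⇔ : 0ℤ ℤ.≤ baryNum t (Vec.map +_ n) zero ⇔ B ≤ A
    origin≥0⇔ = subst (λ v → 0ℤ ℤ.≤ v ⇔ B ≤ A) (sym (baryNum-pos-zero t n)) (0≤+m-+n⇔n≤m A B)
    to : (∀ j → 0ℤ ℤ.≤ baryNum t (Vec.map +_ n) j) → Admissible t n
    to num≥0 = (λ i inner-i → subst₂ _≤_ (if-cong inner-i) (if-cong inner-i) (Equivalence.to (vertex≥0⇔ i) (num≥0 (suc i))))
             , Equivalence.to origin≥0⇔ (num≥0 zero)
    vertex≥0 : Admissible t n → ∀ i → i ≡ last ⊎ inner i ≡ true → 0ℤ ℤ.≤ vertexNum (Vec.map +_ n) i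
    vertex≥0 _ i (inj₁ refl) = Equivalence.from (vertex≥0⇔ last) (subst (_≤ P last) (sym (if-cong inner-last)) z≤n)
    vertex≥0 (adm , _) i (inj₂ inner-i) =
      Equivalence.from (vertex≥0⇔ i) (subst₂ _≤_ (sym (if-cong inner-i)) (sym (if-cong inner-i)) (adm i inner-i))
    from : Admissible t n → ∀ j → 0ℤ ℤ.≤ baryNum t (Vec.map +_ n) j
    from adm zero    = Equivalence.from origin≥0⇔ (proj₂ adm)
    from adm (suc i) = vertex≥0 adm i (last-or-inner i)

  baryNum≥0⇒nonNeg : ∀ t x → (∀ j → 0ℤ ℤ.≤ baryNum t x j) → ∀ i → 0ℤ ℤ.≤ lookup x i
  baryNum≥0⇒nonNeg t x num≥0 i = nonNeg (last-or-inner i)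
    where
    c≥0 : 0ℤ ℤ.≤ lookup x last
    c≥0 = subst (0ℤ ℤ.≤_) (if-cong inner-last) (num≥0 (suc last))
    nonNeg : i ≡ last ⊎ inner i ≡ true → 0ℤ ℤ.≤ lookup x i
    nonNeg (inj₁ refl) = c≥0
    nonNeg (inj₂ inner-i) = ℤP.*-cancelˡ-≤-pos 0ℤ (lookup x i) (+ S) (begin
      + S ℤ.* 0ℤ                   ≡⟨ ℤP.*-zeroʳ (+ S) ⟩
      0ℤ                           ≡⟨ ℤP.*-zeroʳ (+ ωₙ i) ⟨
      + ωₙ i ℤ.* 0ℤ                ≤⟨ ℤP.*-monoˡ-≤-nonNeg (+ ωₙ i) c≥0 ⟩
      + ωₙ i ℤ.* lookup x last     ≤⟨ ℤP.0≤i-j⇒j≤i (subst (0ℤ ℤ.≤_) (if-cong inner-i) (num≥0 (suc i))) ⟩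
      + S ℤ.* lookup x i           ∎)
      where open ℤP.≤-Reasoning

  baryNum≥0⇔admissible : ∀ t x → (∀ j → 0ℤ ℤ.≤ baryNum t x j) ⇔ Σ (Vec ℕ d) (λ n → x ≡ Vec.map +_ n × Admissible t n)
  baryNum≥0⇔admissible t x = mk⇔ to from
    where
    to : (∀ j → 0ℤ ℤ.≤ baryNum t x j) → Σ (Vec ℕ d) (λ n → x ≡ Vec.map +_ n × Admissible t n)
    to num≥0 = n , x≡ , Equivalence.to (baryNum-pos≥0⇔admissible t n) (subst (λ y → ∀ j → 0ℤ ℤ.≤ baryNum t y j) x≡ num≥0)
      where
      n : Vec ℕ d
      n = Vec.map ℤ.∣_∣ x
      x≡ : x ≡ Vec.map +_ n
      x≡ = sym (0≤x⇒map+∣x∣≡x x (baryNum≥0⇒nonNeg t x num≥0))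
    from : Σ (Vec ℕ d) (λ n → x ≡ Vec.map +_ n × Admissible t n) → ∀ j → 0ℤ ℤ.≤ baryNum t x j
    from (n , refl , adm) = Equivalence.from (baryNum-pos≥0⇔admissible t n) adm

module Parametrisation (s d' b : ℕ) (b≤d' : b ≤ d') (balanced : d' ∸ b ≡ b ⊎ d' ∸ b ≡ suc b) where
  open Polytope s d' b

  a : ℕ
  a = d' ∸ b

  -- On inner coordinates ε r i = ⌈ωᵢ r / S⌉, the least excess of xᵢ over ωᵢ q when x_d = S q + r.
  ε : ℕ → Fin d → ℕ
  ε r i = if toℕ i <ᵇ a then signum r else r

  φ : ℕ → Vec ℕ d → Vec ℕ d
  φ r p = tabulate (λ i → onInner 0 (lookup p) i + ωₙ i * lookup p last + ε r i)

  innerSum-threshold : ∀ α β → innerSum (λ i → if toℕ i <ᵇ a then α else β) ≡ a * α + b * β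
  innerSum-threshold α β = trans (sum-threshold d' a α β (m∸n≤m d' b)) (cong (λ m → a * α + m * β) (m∸[m∸n]≡n b≤d'))

  ωₙ-inner : ∀ {i} → inner i ≡ true → ωₙ i ≡ (if toℕ i <ᵇ a then 1 else s)
  ωₙ-inner {i} inner-i = cong (if toℕ i <ᵇ a then 1 else_) (if-cong inner-i)

  innerSum-ω : innerSum ωₙ ≡ a * 1 + b * s
  innerSum-ω = trans (ℕΣ.sum-cong-≗ pointwise) (innerSum-threshold 1 s)
    where
    pointwise : ∀ i → onInner 0 ωₙ i ≡ onInner 0 (λ i → if toℕ i <ᵇ a then 1 else s) i
    pointwise i with last-or-inner i
    ... | inj₁ refl    = trans (if-cong inner-last) (sym (if-cong inner-last))
    ... | inj₂ inner-i = trans (if-cong inner-i) (trans (ωₙ-inner inner-i) (sym (if-cong inner-i)))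

  ε-last : ∀ r → ε r last ≡ r
  ε-last r = cong (if_then signum r else r) (trans (cong (_<ᵇ a) (FinP.toℕ-fromℕ d')) (n≤m⇒m<ᵇn≡false (m∸n≤m d' b)))

  lookup-φ : ∀ r p i → lookup (φ r p) i ≡ onInner 0 (lookup p) i + ωₙ i * lookup p last + ε r i
  lookup-φ r p = VecP.lookup∘tabulate _

  lookup-φ-inner : ∀ r p {i} → inner i ≡ true → lookup (φ r p) i ≡ lookup p i + (ωₙ i * lookup p last + ε r i)
  lookup-φ-inner r p {i} inner-i =
    trans (lookup-φ r p i) (trans (cong (λ u → u + ωₙ i * lookup p last + ε r i) (if-cong inner-i))
                                  (+-assoc (lookup p i) (ωₙ i * lookup p last) (ε r i)))

  last-φ : ∀ r p → lookup (φ r p) last ≡ S * lookup p last + r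
  last-φ r p = trans (lookup-φ r p last)
    (trans (cong₂ (λ u w → u + w * lookup p last + ε r last) (if-cong inner-last) ωₙ-last) (cong (_+_ (S * lookup p last)) (ε-last r)))

  innerSum-φ : ∀ r p → innerSum (lookup (φ r p)) ≡ innerSum (lookup p) + lookup p last * innerSum ωₙ + innerSum (ε r)
  innerSum-φ r p = begin
      innerSum (lookup (φ r p))
    ≡⟨ innerSum-cong (lookup-φ r p) ⟩
      innerSum (λ i → onInner 0 (lookup p) i + ωₙ i * q + ε r i)
    ≡⟨ trans (innerSum-+ (λ i → onInner 0 (lookup p) i + ωₙ i * q) (ε r))
             (cong (_+ innerSum (ε r)) (innerSum-+ (onInner 0 (lookup p)) (λ i → ωₙ i * q))) ⟩
      innerSum (onInner 0 (lookup p)) + innerSum (λ i → ωₙ i * q) + innerSum (ε r)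
    ≡⟨ cong₂ (λ u w → u + w + innerSum (ε r)) (innerSum-onInner (lookup p))
             (trans (innerSum-cong (λ i → *-comm (ωₙ i) q)) (innerSum-* q ωₙ)) ⟩
      innerSum (lookup p) + q * innerSum ωₙ + innerSum (ε r)
    ∎
    where
    open ≡-Reasoning
    q : ℕ
    q = lookup p last

  coordinate-bound⇔ : ∀ {i} → inner i ≡ true → ∀ {q r y} → r ≤ s →
                      ωₙ i * (S * q + r) ≤ S * y ⇔ ωₙ i * q + ε r i ≤ y
  coordinate-bound⇔ {i} inner-i {q} {r} {y} r≤s =
    subst (λ w → w * (S * q + r) ≤ S * y ⇔ w * q + ε r i ≤ y) (sym (ωₙ-inner inner-i)) (by-cases (toℕ i <ᵇ a))
    where
    by-cases : ∀ β → (if β then 1 else s) * (S * q + r) ≤ S * y ⇔ (if β then 1 else s) * q + (if β then signum r else r) ≤ y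
    by-cases true  = subst₂ (λ X Y → X ≤ S * y ⇔ Y ≤ y) (sym (*-identityˡ (S * q + r))) (sym (cong (_+ signum r) (*-identityˡ q)))
                            ([1+s]q+r≤[1+s]y⇔q+sgn[r]≤y r≤s)
    by-cases false = s[[1+s]q+r]≤[1+s]y⇔sq+r≤y r≤s

  total-bound⇔ : ∀ t r p → r ≤ s →
                 S * innerSum (lookup (φ r p)) + lookup (φ r p) last ≤ S * t + lookup (φ r p) last * innerSum ωₙ
                 ⇔ Bound k t r (Vec.sum p)
  total-bound⇔ t r p r≤s
    rewrite innerSum-φ r p | last-φ r p | innerSum-ω | innerSum-threshold (signum r) r
          | Vec-sum≡sum-lookup p | sum≡innerSum+last (lookup p) =
    balanced-bound⇔ t r (innerSum (lookup p)) (lookup p last) balanced r≤s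

  φ-admissible : ∀ t r p → r ≤ s → Bound k t r (Vec.sum p) → Admissible t (φ r p)
  φ-admissible t r p r≤s bound = coordinates , Equivalence.from (total-bound⇔ t r p r≤s) bound
    where
    coordinates : ∀ i → inner i ≡ true → ωₙ i * lookup (φ r p) last ≤ S * lookup (φ r p) i
    coordinates i inner-i =
      subst₂ (λ c y → ωₙ i * c ≤ S * y) (sym (last-φ r p)) (sym (lookup-φ-inner r p inner-i))
             (Equivalence.from (coordinate-bound⇔ inner-i r≤s) (m≤n+m _ (lookup p i)))

  residue quotient : Vec ℕ d → ℕ
  residue  n = lookup n last % S
  quotient n = lookup n last / S

  ρ-vector : Vec ℕ d → Fin d → ℕ
  ρ-vector n i = if inner i then lookup n i ∸ (ωₙ i * quotient n + ε (residue n) i) else quotient n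

  ρ : Vec ℕ d → ℕ × Vec ℕ d
  ρ n = residue n , tabulate (ρ-vector n)

  ρ-φ : ∀ r p → r ≤ s → ρ (φ r p) ≡ (r , p)
  ρ-φ r p r≤s = cong₂ _,_ residue≡ (trans (VecP.tabulate-cong pointwise) (VecP.tabulate∘lookup p))
    where
    residue≡ : residue (φ r p) ≡ r
    residue≡ = trans (cong (_% S) (last-φ r p)) (proj₁ (divMod-unique {q = lookup p last} r≤s))
    quotient≡ : quotient (φ r p) ≡ lookup p last
    quotient≡ = trans (cong (_/ S) (last-φ r p)) (proj₂ (divMod-unique {q = lookup p last} r≤s))
    pointwise : ∀ i → ρ-vector (φ r p) i ≡ lookup p i
    pointwise i rewrite residue≡ | quotient≡ with last-or-inner i
    ... | inj₁ refl    = if-cong inner-last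
    ... | inj₂ inner-i = trans (if-cong inner-i)
                               (trans (cong (_∸ (ωₙ i * lookup p last + ε r i)) (lookup-φ-inner r p inner-i))
                                      (m+n∸n≡m (lookup p i) (ωₙ i * lookup p last + ε r i)))

  ValidParameter : ℕ → ℕ × Vec ℕ d → Set
  ValidParameter t (r , p) = r ≤ s × Bound k t r (Vec.sum p)

  admissible⇒ρ-valid : ∀ t n → Admissible t n → ValidParameter t (ρ n) × φ (residue n) (proj₂ (ρ n)) ≡ n
  admissible⇒ρ-valid t n (coordinates , total) = (r≤s , bound) , φ≡n
    where
    c q r : ℕ
    p : Vec ℕ d
    c = lookup n last
    q = quotient n
    r = residue n
    p = proj₂ (ρ n)
    r≤s : r ≤ s
    r≤s = ≤-pred (m%n<n c S)
    Sq+r≡c : S * q + r ≡ c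
    Sq+r≡c = trans (+-comm (S * q) r) (trans (cong (_+_ r) (*-comm S q)) (sym (m≡m%n+[m/n]*n c S)))
    p-last : lookup p last ≡ q
    p-last = trans (VecP.lookup∘tabulate (ρ-vector n) last) (if-cong inner-last)
    pointwise : ∀ i → i ≡ last ⊎ inner i ≡ true → onInner 0 (lookup p) i + ωₙ i * lookup p last + ε r i ≡ lookup n i
    pointwise i (inj₁ refl) = begin
      onInner 0 (lookup p) last + ωₙ last * lookup p last + ε r last
        ≡⟨ cong₂ (λ u w → u + w * lookup p last + ε r last) (if-cong inner-last) ωₙ-last ⟩
      S * lookup p last + ε r last                                    ≡⟨ cong₂ (λ u v → S * u + v) p-last (ε-last r) ⟩
      S * q + r                                                       ≡⟨ Sq+r≡c ⟩
      c                                                               ∎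
      where open ≡-Reasoning
    pointwise i (inj₂ inner-i) = begin
      onInner 0 (lookup p) i + ωₙ i * lookup p last + ε r i  ≡⟨ cong₂ (λ u v → u + ωₙ i * v + ε r i) (if-cong inner-i) p-last ⟩
      lookup p i + ωₙ i * q + ε r i                          ≡⟨ +-assoc (lookup p i) (ωₙ i * q) (ε r i) ⟩
      lookup p i + (ωₙ i * q + ε r i)
        ≡⟨ cong (_+ (ωₙ i * q + ε r i)) (trans (VecP.lookup∘tabulate (ρ-vector n) i) (if-cong inner-i)) ⟩
      lookup n i ∸ (ωₙ i * q + ε r i) + (ωₙ i * q + ε r i)   ≡⟨ m∸n+n≡m lower-bound ⟩
      lookup n i                                             ∎
      where
      open ≡-Reasoning
      lower-bound : ωₙ i * q + ε r i ≤ lookup n i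
      lower-bound = Equivalence.to (coordinate-bound⇔ inner-i r≤s)
                                   (subst (λ c → ωₙ i * c ≤ S * lookup n i) (sym Sq+r≡c) (coordinates i inner-i))
    φ≡n : φ r p ≡ n
    φ≡n = trans (VecP.tabulate-cong (λ i → pointwise i (last-or-inner i))) (VecP.tabulate∘lookup n)
    bound : Bound k t r (Vec.sum p)
    bound = Equivalence.to (total-bound⇔ t r p r≤s)
                           (subst (λ m → S * innerSum (lookup m) + lookup m last ≤ S * t + lookup m last * innerSum ωₙ) (sym φ≡n) total)

module Counting (s d' b : ℕ) (b≤d' : b ≤ d') (balanced : d' ∸ b ≡ b ⊎ d' ∸ b ≡ suc b) where
  open Polytope s d' b
  open Parametrisation s d' b b≤d' balanced

  boundedMinusK : ℕ → List (Vec ℕ d)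
  boundedMinusK t with k ≤? t
  ... | yes _ = bounded d (t ∸ k)
  ... | no  _ = []

  ∈-boundedMinusK⇔ : ∀ t {p} → p ∈ boundedMinusK t ⇔ Vec.sum p + k ≤ t
  ∈-boundedMinusK⇔ t {p} with k ≤? t
  ... | yes k≤t = mk⇔ (m≤o∸n⇒m+n≤o (Vec.sum p) k≤t ∘ ∈-bounded⇒ d (t ∸ k))
                      (∈-bounded⇐ d (t ∸ k) p ∘ m+n≤o⇒m≤o∸n (Vec.sum p))
  ... | no  k≰t = mk⇔ (λ ()) (λ p+k≤t → contradiction (≤-trans (m≤n+m k (Vec.sum p)) p+k≤t) k≰t)

  boundedMinusK-unique : ∀ t → Unique (boundedMinusK t)
  boundedMinusK-unique t with k ≤? t
  ... | yes _ = bounded-unique d (t ∸ k)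
  ... | no  _ = Unique.[]

  withResidue0 : Vec ℕ d → ℕ × Vec ℕ d
  withResidue0 p = 0 , p

  parameters : ℕ → List (ℕ × Vec ℕ d)
  parameters t = map withResidue0 (bounded d t) ++ cartesianProduct (applyUpTo suc s) (boundedMinusK t)

  ∈-parameters⇔ : ∀ t {r p} → (r , p) ∈ parameters t ⇔ ValidParameter t (r , p)
  ∈-parameters⇔ t {r} {p} = mk⇔ to (from r p)
    where
    to : (r , p) ∈ parameters t → ValidParameter t (r , p)
    to rp∈ with ∈-++⁻ (map withResidue0 (bounded d t)) rp∈
    ... | inj₁ rp∈₁ with _ , p∈ , refl ← ∈-map⁻ withResidue0 rp∈₁ = z≤n , ∈-bounded⇒ d t p∈
    ... | inj₂ rp∈₂ with r∈ , p∈ ← ∈-cartesianProduct⁻ (applyUpTo suc s) (boundedMinusK t) rp∈₂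
                    with i , i<s , refl ← ∈-applyUpTo⁻ suc r∈ = i<s , Equivalence.to (∈-boundedMinusK⇔ t) p∈
    from : ∀ r p → ValidParameter t (r , p) → (r , p) ∈ parameters t
    from zero    p (_ , bound)   = ∈-++⁺ˡ (∈-map⁺ withResidue0 (∈-bounded⇐ d t p bound))
    from (suc i) p (r≤s , bound) = ∈-++⁺ʳ (map withResidue0 (bounded d t))
                                   (∈-cartesianProduct⁺ (∈-applyUpTo⁺ suc r≤s) (Equivalence.from (∈-boundedMinusK⇔ t) bound))

  parameters-unique : ∀ t → Unique (parameters t)
  parameters-unique t =
    Unique.++⁺ (Unique.map⁺ (cong proj₂) (bounded-unique d t))
               (Unique.cartesianProduct⁺ (Unique.applyUpTo⁺₁ suc s (λ i<j _ → <⇒≢ i<j ∘ suc-injective)) (boundedMinusK-unique t))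
               disjoint
    where
    disjoint : ∀ {rp} → rp ∈ map withResidue0 (bounded d t) × rp ∈ cartesianProduct (applyUpTo suc s) (boundedMinusK t) → ⊥
    disjoint (rp∈₁ , rp∈₂) with _ , _ , refl ← ∈-map⁻ withResidue0 rp∈₁
                           with r∈ , _ ← ∈-cartesianProduct⁻ (applyUpTo suc s) (boundedMinusK t) rp∈₂
                           with _ , _ , () ← ∈-applyUpTo⁻ suc r∈

  length-parameters : ∀ t → length (parameters t) ≡ (t + d) C d + s * length (boundedMinusK t)
  length-parameters t = begin
      length (map withResidue0 (bounded d t) ++ cartesianProduct (applyUpTo suc s) (boundedMinusK t))
    ≡⟨ ListP.length-++ (map withResidue0 (bounded d t)) ⟩
      length (map withResidue0 (bounded d t)) + length (cartesianProduct (applyUpTo suc s) (boundedMinusK t))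
    ≡⟨ cong₂ _+_ (trans (ListP.length-map withResidue0 (bounded d t)) (length-bounded d t))
                 (trans (length-cartesianProduct (applyUpTo suc s) (boundedMinusK t))
                        (cong (_* length (boundedMinusK t)) (ListP.length-applyUpTo suc s))) ⟩
      (t + d) C d + s * length (boundedMinusK t)
    ∎
    where open ≡-Reasoning

  latticePoint : ℕ × Vec ℕ d → Vec ℤ d
  latticePoint (r , p) = Vec.map +_ (φ r p)

  latticePoints : ℕ → List (Vec ℤ d)
  latticePoints t = map latticePoint (parameters t)

  ∈-latticePoints⇔ : ∀ t {x} → x ∈ latticePoints t ⇔ InDilate d (suc d) (M-vertices s d k) t x
  ∈-latticePoints⇔ t {x} = mk⇔ to from
    where
    to : x ∈ latticePoints t → InDilate d (suc d) (M-vertices s d k) t x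
    to x∈ with (r , p) , rp∈ , x≡ ← ∈-map⁻ latticePoint x∈ =
      let (r≤s , bound) = Equivalence.to (∈-parameters⇔ t) rp∈ in
      Equivalence.from (inDilate⇔baryNum≥0 t x)
        (Equivalence.from (baryNum≥0⇔admissible t x) (φ r p , x≡ , φ-admissible t r p r≤s bound))
    from : InDilate d (suc d) (M-vertices s d k) t x → x ∈ latticePoints t
    from x∈tM with n , x≡ , admissible ← Equivalence.to (baryNum≥0⇔admissible t x) (Equivalence.to (inDilate⇔baryNum≥0 t x) x∈tM) =
      let (valid , φ≡n) = admissible⇒ρ-valid t n admissible in
      subst (_∈ latticePoints t) (trans (cong (λ v → Vec.map +_ v) φ≡n) (sym x≡))
            (∈-map⁺ latticePoint (Equivalence.from (∈-parameters⇔ t) valid))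

  latticePoints-unique : ∀ t → Unique (latticePoints t)
  latticePoints-unique t = Unique-map⁺ (ρ ∘ Vec.map ℤ.∣_∣) (All.tabulate left-inverse) (parameters-unique t)
    where
    left-inverse : ∀ {rp} → rp ∈ parameters t → ρ (Vec.map ℤ.∣_∣ (latticePoint rp)) ≡ rp
    left-inverse {r , p} rp∈ = trans (cong ρ (trans (sym (VecP.map-∘ ℤ.∣_∣ +_ (φ r p))) (VecP.map-id (φ r p))))
                                     (ρ-φ r p (proj₁ (Equivalence.to (∈-parameters⇔ t) rp∈)))

  latticeCount : ∀ t → LatticeCount d (suc d) (M-vertices s d k) t (length (latticePoints t))
  latticeCount t = latticePoints t , refl , latticePoints-unique t , λ x → ∈-latticePoints⇔ t

  ehrhart : ℕ → ℕ
  ehrhart t = length (latticePoints t)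

  length-boundedMinusK : ∀ t → + length (boundedMinusK t) ≡ shift k (binomial d) t
  length-boundedMinusK t with k ≤? t
  ... | yes _ = cong +_ (length-bounded d (t ∸ k))
  ... | no  _ = refl

  ehrhartSeries≡ : ∀ m → ehrhartSeries ehrhart m ≡ binomial d m ℤ.+ + s ℤ.* shift k (binomial d) m
  ehrhartSeries≡ zero    = sym (trans (cong (ℤ._+_ (+ (d C d))) (ℤP.*-zeroʳ (+ s))) (cong +_ (trans (+-identityʳ _) (nCn≡1 d))))
  ehrhartSeries≡ (suc m) = begin
      + length (latticePoints (suc m))
    ≡⟨ cong +_ (trans (ListP.length-map latticePoint (parameters (suc m))) (length-parameters (suc m))) ⟩
      + ((suc m + d) C d + s * length (boundedMinusK (suc m)))
    ≡⟨ ℤP.pos-+ _ (s * length (boundedMinusK (suc m))) ⟩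
      binomial d (suc m) ℤ.+ + (s * length (boundedMinusK (suc m)))
    ≡⟨ cong (ℤ._+_ (binomial d (suc m))) (trans (ℤP.pos-* s _) (cong (ℤ._*_ (+ s)) (length-boundedMinusK (suc m)))) ⟩
      binomial d (suc m) ℤ.+ + s ℤ.* shift k (binomial d) (suc m)
    ∎
    where open ≡-Reasoning

parity⇒balanced : ∀ {d' b} → suc d' ≡ (suc b + suc b) ∸ 1 ⊎ suc d' ≡ suc b + suc b →
                  b ≤ d' × (d' ∸ b ≡ b ⊎ d' ∸ b ≡ suc b)
parity⇒balanced {b = b} (inj₁ d≡2k-1) with refl ← suc-injective (trans d≡2k-1 (+-suc b b)) = m≤m+n b b , inj₁ (m+n∸m≡n b b)
parity⇒balanced {b = b} (inj₂ d≡2k)   with refl ← suc-injective d≡2k = m≤m+n b (suc b) , inj₂ (m+n∸m≡n b (suc b))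

-- 3 ≤ d only rules out d = 0: the count and the h*-polynomial hold in every positive dimension.
corollary4p5 : (s d k : ℕ) → 3 ≤ d → (d ≡ (k + k) ∸ 1 ⊎ d ≡ k + k) →
    Σ (ℕ → ℕ) λ i →
    ((t : ℕ) → LatticeCount d (Data.Nat.suc d) (M-vertices s d k) t (i t))
    × ((n : ℕ) → hstarCoeff d (ehrhartSeries i) n ≡ target s k n)
corollary4p5 s (suc d') zero    _ (inj₁ ())
corollary4p5 s (suc d') zero    _ (inj₂ ())
corollary4p5 s (suc d') (suc b) _ parity =
  ehrhart , latticeCount , hstar-binomial+shifted (suc d') (suc b) s (ehrhartSeries ehrhart) ehrhartSeries≡
  where
  balanced : b ≤ d' × (d' ∸ b ≡ b ⊎ d' ∸ b ≡ suc b)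
  balanced = parity⇒balanced parity
  open Counting s d' b (proj₁ balanced) (proj₂ balanced)
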